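{- Let $d\ge 2$, let $q\equiv 1\pmod d$ be a prime power and let $\lambda\in\mathbb{F}_q^*$. Then $MSD_d(\lambda,\mathbb{F}_q)\le \frac{\sqrt{4q-3}+1}{2}$ and $MD_d(\lambda,\mathbb{F}_q)\le \sqrt{q-\frac{11}{4}}+\frac52$.
   Context: $S_d=\{x^d:x\in\mathbb{F}_q^*\}$. A set $\{a_1,\dots,a_m\}$ of distinct elements of $\mathbb{F}_q^*$ has property $D_d(\lambda,\mathbb{F}_q)$ if $a_ia_j+\lambda\in S_d\cup\{0\}$ whenever $i\ne j$, and property $SD_d(\lambda,\mathbb{F}_q)$ if $a_ia_j+\lambda\in S_d\cup\{0\}$ for all $i,j$ (including $i=j$). $MD_d(\lambda,\mathbb{F}_q)$ and $MSD_d(\lambda,\mathbb{F}_q)$ denote the maximum size of a subset of $\mathbb{F}_q^*$ with property $D_d(\lambda,\mathbb{F}_q)$, respectively $SD_d(\lambda,\mathbb{F}_q)$. -}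

module Defs where

open import Level using (0ℓ)
open import Data.Nat using (ℕ; zero; suc)
open import Data.Fin using (Fin)
open import Data.Product using (Σ; _×_)
open import Data.Sum using (_⊎_)
open import Data.List using (List)
open import Data.List.Membership.Propositional using (_∈_)
open import Relation.Nullary using (¬_)
open import Relation.Binary.PropositionalEquality using (_≡_)
open import Relation.Binary.Definitions using (DecidableEquality)
open import Algebra.Structures using (IsCommutativeRing)
open import Function.Bundles using (_↔_)

record FiniteField : Set₁ where
  field
    F    : Set
    _≟_  : DecidableEquality F
    _+_  : F → F → F
    _*_  : F → F → F
    -_   : F → F
    0#   : F
    1#   : F
    isCommutativeRing : IsCommutativeRing _≡_ _+_ _*_ -_ 0# 1#
    0≢1  : ¬ (0# ≡ 1#)
    inv  : (x : F) → ¬ (x ≡ 0#) → F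
    inv-r : (x : F) (x≢0 : ¬ (x ≡ 0#)) → x * inv x x≢0 ≡ 1#
    size : ℕ
    enum : F ↔ Fin size

  infixl 7 _*_
  infixl 6 _+_

  _^_ : F → ℕ → F
  x ^ zero  = 1#
  x ^ suc n = x * (x ^ n)

  InS : ℕ → F → Set
  InS d z = Σ F (λ x → ¬ (x ≡ 0#) × (x ^ d ≡ z))

  DistinctNonzero : List F → Set
  DistinctNonzero as = Unique as × (∀ {a} → a ∈ as → ¬ (a ≡ 0#))
    where open import Data.List.Relation.Unary.Unique.Propositional using (Unique)

  HasD : ℕ → F → List F → Set
  HasD d λ′ as = DistinctNonzero as ×
    (∀ {a b} → a ∈ as → b ∈ as → ¬ (a ≡ b) →
      InS d (a * b + λ′) ⊎ (a * b + λ′ ≡ 0#))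

  HasSD : ℕ → F → List F → Set
  HasSD d λ′ as = DistinctNonzero as ×
    (∀ {a b} → a ∈ as → b ∈ as →
      InS d (a * b + λ′) ⊎ (a * b + λ′ ≡ 0#))

{-# OPTIONS --safe #-}
-- Let H ⊆ F_q^* be the subgroup of d-th powers, h = |H|, N = q − 1 and r = N − h. Since d ∣ N and d ≥ 2,
-- some unit is not a d-th power (otherwise X^(N/d) − 1 would have N roots), so H and a coset of it are
-- disjoint and r ≥ h. For A = {a₁, …, aₘ} and x ∈ F_q put S(x, t) = #{b ∈ A : t (x b + λ) ∈ H}.
-- For each x, Cauchy–Schwarz over the N units t bounds (∑ₜ S(x, t))² by N ∑ₜ S(x, t)². Summed over x,
-- both sides are computed exactly by counting pairs b, b′ ∈ A (after substituting s = t x), and this shows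
-- that the Cauchy–Schwarz deficits add up to at most m h r q. The point x = 0 has deficit m² h r.
-- For x ∈ A, property SD makes S(x, ·) a multiple of the indicator of H, with deficit at least
-- (m − 1)² h r; property D does so up to one more coset of H, with deficit at least (m − 3)² h r.
-- Hence m + (m − 1)² ≤ q, respectively m + (m − 3)² ≤ q, which are the two bounds.
module Submission where

open import Defs
open import Level using (0ℓ)
open import Algebra.Bundles using (CommutativeMonoid; CommutativeSemigroup)
open import Algebra.Structures using (IsCommutativeRing)
import Algebra.Properties.CommutativeSemigroup as CommutativeSemigroupProperties
import Algebra.Properties.Semiring.Sum as SemiringSum
open import Data.Empty using (⊥-elim)
open import Data.Fin using (Fin; zero; suc; punchIn)
import Data.Fin.Properties as Finₚ
open import Data.List using (List; []; _∷_; length)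
open import Data.List.Membership.Propositional using (_∈_)
open import Data.List.Relation.Unary.All using (All)
import Data.List.Relation.Unary.All as All
open import Data.List.Relation.Unary.Any using (here; there)
import Data.List.Relation.Unary.AllPairs as AllPairs
open import Data.List.Relation.Unary.Unique.Propositional using (Unique)
open import Data.Nat using (ℕ; zero; suc; _+_; _*_; _∸_; _^_; _≤_; z≤n; s≤s; NonZero; >-nonZero)
open import Data.Nat.Divisibility using (_∣_; divides)
open import Data.Nat.Primality using (Prime)
open import Data.Nat.Properties hiding (_≟_)
open import Data.Nat.Tactic.RingSolver using (solve)
open import Data.Product using (Σ; ∃; _×_; _,_; proj₁; proj₂)
open import Data.Sum using (_⊎_; inj₁; inj₂)
open import Function using (_∘_; Inverse)
open import Function.Definitions using (Injective)
open import Function.Bundles using (_↔_; mk↔ₛ′)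
open import Function.Construct.Composition using (_↔-∘_)
open import Function.Construct.Symmetry using (↔-sym)
open import Relation.Binary.Definitions using (DecidableEquality)
open import Relation.Binary.PropositionalEquality
open import Data.Bool using (true; false)
open import Relation.Nullary using (¬_; Dec; yes; no; _because_)
open import Relation.Nullary.Decidable using (¬?; _×-dec_; map′)

private
  module Fin∑ = SemiringSum +-*-semiring

open CommutativeSemigroupProperties *-commutativeSemigroup using (x∙yz≈y∙xz; interchange)

2mn≤m²+n² : ∀ m n → 2 * (m * n) ≤ m * m + n * n
2mn≤m²+n² zero n = z≤n
2mn≤m²+n² (suc m) zero rewrite *-zeroʳ m = z≤n
2mn≤m²+n² (suc m) (suc n) = begin
  2 * (suc m * suc n)             ≡⟨ solve (m ∷ n ∷ []) ⟩
  2 + 2 * m + 2 * n + 2 * (m * n) ≤⟨ +-monoʳ-≤ (2 + 2 * m + 2 * n) (2mn≤m²+n² m n) ⟩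
  2 + 2 * m + 2 * n + (m * m + n * n) ≡⟨ solve (m ∷ n ∷ []) ⟩
  suc m * suc m + suc n * suc n   ∎
  where open ≤-Reasoning

-- The induction for the weighted Cauchy–Schwarz inequality carries the cross-term bound
-- 2 x ∑ wᵢsᵢ ≤ x² ∑ wᵢ + ∑ wᵢsᵢ², i.e. ∑ wᵢ (x − sᵢ)² ≥ 0.
private
  cross-step : ∀ x w₀ s₀ S W Q → 2 * (x * S) ≤ x * x * W + Q →
    2 * (x * (w₀ * s₀ + S)) ≤ x * x * (w₀ + W) + (w₀ * (s₀ * s₀) + Q)
  cross-step x w₀ s₀ S W Q ih = begin
    2 * (x * (w₀ * s₀ + S))                  ≡⟨ solve (x ∷ w₀ ∷ s₀ ∷ S ∷ []) ⟩
    w₀ * (2 * (x * s₀)) + 2 * (x * S)          ≤⟨ +-mono-≤ (*-monoʳ-≤ w₀ (2mn≤m²+n² x s₀)) ih ⟩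
    w₀ * (x * x + s₀ * s₀) + (x * x * W + Q)   ≡⟨ solve (x ∷ w₀ ∷ s₀ ∷ W ∷ Q ∷ []) ⟩
    x * x * (w₀ + W) + (w₀ * (s₀ * s₀) + Q)    ∎
    where open ≤-Reasoning

  cauchy-schwarz-step : ∀ w₀ s₀ S W Q → 2 * (s₀ * S) ≤ s₀ * s₀ * W + Q → S * S ≤ W * Q →
    (w₀ * s₀ + S) * (w₀ * s₀ + S) ≤ (w₀ + W) * (w₀ * (s₀ * s₀) + Q)
  cauchy-schwarz-step w₀ s₀ S W Q cross ih = begin
    (w₀ * s₀ + S) * (w₀ * s₀ + S)                        ≡⟨ solve (w₀ ∷ s₀ ∷ S ∷ []) ⟩
    w₀ * w₀ * (s₀ * s₀) + w₀ * (2 * (s₀ * S)) + S * S     ≤⟨ +-mono-≤ (+-monoʳ-≤ (w₀ * w₀ * (s₀ * s₀))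
                                                              (*-monoʳ-≤ w₀ cross)) ih ⟩
    w₀ * w₀ * (s₀ * s₀) + w₀ * (s₀ * s₀ * W + Q) + W * Q  ≡⟨ solve (w₀ ∷ s₀ ∷ W ∷ Q ∷ []) ⟩
    (w₀ + W) * (w₀ * (s₀ * s₀) + Q)                       ∎
    where open ≤-Reasoning

  sum-cross : ∀ {k} x (w s : Fin k → ℕ) →
    2 * (x * Fin∑.sum (λ i → w i * s i)) ≤ x * x * Fin∑.sum w + Fin∑.sum (λ i → w i * (s i * s i))
  sum-cross {zero} x w s rewrite *-zeroʳ x | *-zeroʳ (x * x) = z≤n
  sum-cross {suc k} x w s = cross-step x (w zero) (s zero) _ _ _ (sum-cross x (w ∘ suc) (s ∘ suc))

sum-cauchy-schwarz : ∀ {k} (w s : Fin k → ℕ) →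
  Fin∑.sum (λ i → w i * s i) * Fin∑.sum (λ i → w i * s i) ≤ Fin∑.sum w * Fin∑.sum (λ i → w i * (s i * s i))
sum-cauchy-schwarz {zero} w s = z≤n
sum-cauchy-schwarz {suc k} w s =
  cauchy-schwarz-step (w zero) (s zero) _ _ _ (sum-cross (s zero) (w ∘ suc) (s ∘ suc)) (sum-cauchy-schwarz (w ∘ suc) (s ∘ suc))

sum-const : ∀ {k} c → Fin∑.sum {k} (λ _ → c) ≡ k * c
sum-const {zero} c = refl
sum-const {suc k} c = cong (c +_) (sum-const {k} c)

sum-mono-≤ : ∀ {k} {f g : Fin k → ℕ} → (∀ i → f i ≤ g i) → Fin∑.sum f ≤ Fin∑.sum g
sum-mono-≤ {zero} le = z≤n
sum-mono-≤ {suc k} le = +-mono-≤ (le zero) (sum-mono-≤ (le ∘ suc))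

sum-zero : ∀ {k} {f : Fin k → ℕ} → (∀ i → f i ≡ 0) → Fin∑.sum f ≡ 0
sum-zero {k} vanish = trans (Fin∑.sum-cong-≗ vanish) (Fin∑.sum-replicate-zero k)

sum-supported-at : ∀ {k} (f : Fin k → ℕ) i → (∀ j → j ≢ i → f j ≡ 0) → Fin∑.sum f ≡ f i
sum-supported-at {suc k} f i vanish = begin
  Fin∑.sum f                              ≡⟨ Fin∑.sum-remove {i = i} f ⟩
  f i + Fin∑.sum (f ∘ punchIn i)          ≡⟨ cong (f i +_) (sum-zero (λ j → vanish (punchIn i j) (Finₚ.punchInᵢ≢i i j))) ⟩
  f i + 0                                 ≡⟨ +-identityʳ (f i) ⟩
  f i                                     ∎
  where open ≡-Reasoning

𝟙 : ∀ {p} {P : Set p} → Dec P → ℕ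
𝟙 (true because _) = 1
𝟙 (false because _) = 0

module _ {p} {P : Set p} where

  𝟙-yes : (P? : Dec P) → P → 𝟙 P? ≡ 1
  𝟙-yes (yes _) _ = refl
  𝟙-yes (no ¬P) P = ⊥-elim (¬P P)

  𝟙-no : (P? : Dec P) → ¬ P → 𝟙 P? ≡ 0
  𝟙-no (yes P) ¬P = ⊥-elim (¬P P)
  𝟙-no (no _) _ = refl

  𝟙≤1 : (P? : Dec P) → 𝟙 P? ≤ 1
  𝟙≤1 (yes _) = s≤s z≤n
  𝟙≤1 (no _) = z≤n

  𝟙-idem : (P? : Dec P) → 𝟙 P? * 𝟙 P? ≡ 𝟙 P?
  𝟙-idem (yes _) = refl
  𝟙-idem (no _) = refl

  𝟙-+-𝟙¬ : (P? : Dec P) → 𝟙 P? + 𝟙 (¬? P?) ≡ 1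
  𝟙-+-𝟙¬ (yes _) = refl
  𝟙-+-𝟙¬ (no _) = refl

  𝟙-partition : (P? : Dec P) (k : ℕ) → 𝟙 P? * k + 𝟙 (¬? P?) * k ≡ k
  𝟙-partition P? k = trans (sym (*-distribʳ-+ k (𝟙 P?) (𝟙 (¬? P?)))) (trans (cong (_* k) (𝟙-+-𝟙¬ P?)) (*-identityˡ k))

-- Sums over finitely enumerated types

module EnumeratedFold {c ℓ} (M : CommutativeMonoid c ℓ) {A : Set} {n : ℕ} (enum : A ↔ Fin n) where
  open CommutativeMonoid M using (Carrier; _≈_; _∙_; reflexive) renaming (sym to ≈-sym; trans to ≈-trans)
  open import Algebra.Properties.CommutativeMonoid.Sum M using (sum; sum-cong-≗; ∑-distrib-+; sum-permute)
  open Inverse enum using (from; strictlyInverseʳ)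

  fold : (A → Carrier) → Carrier
  fold f = sum (f ∘ from)

  fold-cong : ∀ {f g : A → Carrier} → (∀ x → f x ≡ g x) → fold f ≡ fold g
  fold-cong f≗g = sum-cong-≗ (f≗g ∘ from)

  fold-distrib : ∀ (f g : A → Carrier) → fold (λ x → f x ∙ g x) ≈ fold f ∙ fold g
  fold-distrib f g = ∑-distrib-+ (f ∘ from) (g ∘ from)

  fold-reindex : ∀ (σ : A ↔ A) (f : A → Carrier) → fold (f ∘ Inverse.to σ) ≈ fold f
  fold-reindex σ f = ≈-sym (≈-trans (sum-permute (f ∘ from) (enum ↔-∘ (σ ↔-∘ ↔-sym enum)))
                                (reflexive (sum-cong-≗ (λ i → cong f (strictlyInverseʳ (Inverse.to σ (from i)))))))

module EnumeratedSum {A : Set} {n : ℕ} (enum : A ↔ Fin n) where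
  open Inverse enum using (to; from; strictlyInverseˡ; strictlyInverseʳ)
  open EnumeratedFold +-0-commutativeMonoid enum public
    renaming (fold to ∑; fold-cong to ∑-cong; fold-distrib to ∑-distrib-+; fold-reindex to ∑-reindex)

  ∑-*ˡ : ∀ c (f : A → ℕ) → ∑ (λ x → c * f x) ≡ c * ∑ f
  ∑-*ˡ c f = sym (Fin∑.*-distribˡ-sum c (f ∘ from))

  ∑-*ʳ : ∀ c (f : A → ℕ) → ∑ (λ x → f x * c) ≡ ∑ f * c
  ∑-*ʳ c f = sym (Fin∑.*-distribʳ-sum c (f ∘ from))

  ∑-const : ∀ c → ∑ (λ _ → c) ≡ n * c
  ∑-const c = sum-const {n} c

  ∑-mono-≤ : ∀ {f g : A → ℕ} → (∀ x → f x ≤ g x) → ∑ f ≤ ∑ g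
  ∑-mono-≤ f≤g = sum-mono-≤ (f≤g ∘ from)

  ∑-zero : ∀ {f : A → ℕ} → (∀ x → f x ≡ 0) → ∑ f ≡ 0
  ∑-zero vanish = sum-zero (vanish ∘ from)

  ∑-comm : ∀ (f : A → A → ℕ) → ∑ (λ x → ∑ (λ y → f x y)) ≡ ∑ (λ y → ∑ (λ x → f x y))
  ∑-comm f = Fin∑.∑-comm (λ i j → f (from i) (from j))

  ∑-cauchy-schwarz : ∀ (w s : A → ℕ) →
    ∑ (λ x → w x * s x) * ∑ (λ x → w x * s x) ≤ ∑ w * ∑ (λ x → w x * (s x * s x))
  ∑-cauchy-schwarz w s = sum-cauchy-schwarz (w ∘ from) (s ∘ from)

  ∑-weighted-comm : ∀ (w : A → ℕ) (f : A → A → ℕ) →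
    ∑ (λ x → ∑ (λ b → w b * f x b)) ≡ ∑ (λ b → w b * ∑ (λ x → f x b))
  ∑-weighted-comm w f = trans (∑-comm (λ x b → w b * f x b)) (∑-cong (λ b → ∑-*ˡ (w b) (λ x → f x b)))

  ∑-weighted-square : ∀ (w v : A → ℕ) →
    ∑ (λ b → w b * v b) * ∑ (λ b → w b * v b) ≡ ∑ (λ b → w b * ∑ (λ b′ → w b′ * (v b * v b′)))
  ∑-weighted-square w v = begin
    ∑ wv * ∑ wv                                        ≡⟨ ∑-*ʳ (∑ wv) wv ⟨
    ∑ (λ b → w b * v b * ∑ wv)                         ≡⟨ ∑-cong (λ b → *-assoc (w b) (v b) (∑ wv)) ⟩
    ∑ (λ b → w b * (v b * ∑ wv))                       ≡⟨ ∑-cong (λ b → cong (w b *_) (∑-*ˡ (v b) wv)) ⟨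
    ∑ (λ b → w b * ∑ (λ b′ → v b * (w b′ * v b′)))     ≡⟨ ∑-cong (λ b → cong (w b *_) (∑-cong (λ b′ → x∙yz≈y∙xz (v b) (w b′) (v b′)))) ⟩
    ∑ (λ b → w b * ∑ (λ b′ → w b′ * (v b * v b′)))     ∎
    where
    open ≡-Reasoning
    wv : A → ℕ
    wv b = w b * v b

  ∑-∑-weighted-square : ∀ (w : A → ℕ) (u : A → A → ℕ) →
    ∑ (λ x → ∑ (λ b → w b * u x b) * ∑ (λ b → w b * u x b)) ≡
    ∑ (λ b → w b * ∑ (λ b′ → w b′ * ∑ (λ x → u x b * u x b′)))
  ∑-∑-weighted-square w u = begin
    ∑ (λ x → ∑ (λ b → w b * u x b) * ∑ (λ b → w b * u x b))       ≡⟨ ∑-cong (λ x → ∑-weighted-square w (u x)) ⟩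
    ∑ (λ x → ∑ (λ b → w b * ∑ (λ b′ → w b′ * (u x b * u x b′))))  ≡⟨ ∑-weighted-comm w (λ x b → ∑ (λ b′ → w b′ * (u x b * u x b′))) ⟩
    ∑ (λ b → w b * ∑ (λ x → ∑ (λ b′ → w b′ * (u x b * u x b′))))  ≡⟨ ∑-cong (λ b → cong (w b *_) (∑-weighted-comm w (λ x b′ → u x b * u x b′))) ⟩
    ∑ (λ b → w b * ∑ (λ b′ → w b′ * ∑ (λ x → u x b * u x b′)))     ∎
    where open ≡-Reasoning

  -- The equality case of Cauchy–Schwarz over h + r points.
  ∑-scaled-indicator-square : ∀ k {f : A → ℕ} {h} r → (∀ x → f x * f x ≡ f x) → ∑ f ≡ h →
    ∑ (λ x → k * f x) * ∑ (λ x → k * f x) + k * k * (h * r) ≡ (h + r) * ∑ (λ x → k * f x * (k * f x))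
  ∑-scaled-indicator-square k {f} {h} r f-idem ∑f≡h = begin
    ∑ (λ x → k * f x) * ∑ (λ x → k * f x) + k * k * (h * r)  ≡⟨ cong (λ s → s * s + k * k * (h * r)) ∑kf≡kh ⟩
    k * h * (k * h) + k * k * (h * r)                        ≡⟨ solve (k ∷ h ∷ r ∷ []) ⟩
    (h + r) * (k * k * h)                                    ≡⟨ cong ((h + r) *_) ∑kf²≡kkh ⟨
    (h + r) * ∑ (λ x → k * f x * (k * f x))                  ∎
    where
    open ≡-Reasoning
    ∑kf≡kh : ∑ (λ x → k * f x) ≡ k * h
    ∑kf≡kh = trans (∑-*ˡ k f) (cong (k *_) ∑f≡h)
    ∑kf²≡kkh : ∑ (λ x → k * f x * (k * f x)) ≡ k * k * h
    ∑kf²≡kkh = trans (∑-cong (λ x → trans (interchange k (f x) k (f x)) (cong (k * k *_) (f-idem x))))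
                     (trans (∑-*ˡ (k * k) f) (cong (k * k *_) ∑f≡h))

  ∑-supported-at : ∀ (f : A → ℕ) c → (∀ x → x ≢ c → f x ≡ 0) → ∑ f ≡ f c
  ∑-supported-at f c vanish = begin
    ∑ f                ≡⟨ sum-supported-at (f ∘ from) (to c) vanish′ ⟩
    f (from (to c))    ≡⟨ cong f (strictlyInverseʳ c) ⟩
    f c                ∎
    where
    open ≡-Reasoning
    vanish′ : ∀ j → j ≢ to c → f (from j) ≡ 0
    vanish′ j j≢ = vanish (from j) (λ e → j≢ (trans (sym (strictlyInverseˡ j)) (cong to e)))

  module WithDecidableEquality (_≟_ : DecidableEquality A) where
    open import Data.List.Membership.DecPropositional _≟_ using (_∈?_)

    ∑-δ : ∀ c (g : A → ℕ) → ∑ (λ x → 𝟙 (x ≟ c) * g x) ≡ g c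
    ∑-δ c g = trans (∑-supported-at _ c (λ x x≢c → cong (_* g x) (𝟙-no (x ≟ c) x≢c)))
                    (trans (cong (_* g c) (𝟙-yes (c ≟ c) refl)) (+-identityʳ (g c)))

    ∑-𝟙≡ : ∀ c → ∑ (λ x → 𝟙 (x ≟ c)) ≡ 1
    ∑-𝟙≡ c = trans (∑-cong (λ x → sym (*-identityʳ (𝟙 (x ≟ c))))) (∑-δ c (λ _ → 1))

    ∑-split : ∀ c (f : A → ℕ) → ∑ f ≡ f c + ∑ (λ x → 𝟙 (¬? (x ≟ c)) * f x)
    ∑-split c f = begin
      ∑ f                                                         ≡⟨ ∑-cong (λ x → sym (𝟙-partition (x ≟ c) (f x))) ⟩
      ∑ (λ x → 𝟙 (x ≟ c) * f x + 𝟙 (¬? (x ≟ c)) * f x)           ≡⟨ ∑-distrib-+ (λ x → 𝟙 (x ≟ c) * f x) rest ⟩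
      ∑ (λ x → 𝟙 (x ≟ c) * f x) + ∑ rest                         ≡⟨ cong (_+ ∑ rest) (∑-δ c f) ⟩
      f c + ∑ rest                                               ∎
      where
      open ≡-Reasoning
      rest : A → ℕ
      rest x = 𝟙 (¬? (x ≟ c)) * f x

    term≤∑ : ∀ c (f : A → ℕ) → f c ≤ ∑ f
    term≤∑ c f = subst (f c ≤_) (sym (∑-split c f)) (m≤m+n (f c) _)

    private
      𝟙-∈-∷ : ∀ {a xs} → All (a ≢_) xs → ∀ x → 𝟙 (x ∈? (a ∷ xs)) ≡ 𝟙 (x ≟ a) + 𝟙 (x ∈? xs)
      𝟙-∈-∷ {a} {xs} a∉xs x with x ≟ a | x ∈? xs
      ... | yes refl | yes x∈xs = ⊥-elim (All.lookup a∉xs x∈xs refl)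
      ... | yes _ | no _ = refl
      ... | no _ | yes _ = refl
      ... | no _ | no _ = refl

    ∑-𝟙∈ : ∀ {xs} → Unique xs → ∑ (λ x → 𝟙 (x ∈? xs)) ≡ length xs
    ∑-𝟙∈ {[]} _ = ∑-zero (λ _ → refl)
    ∑-𝟙∈ {a ∷ xs} (a∉xs AllPairs.∷ unique) = begin
      ∑ (λ x → 𝟙 (x ∈? (a ∷ xs)))                  ≡⟨ ∑-cong (𝟙-∈-∷ a∉xs) ⟩
      ∑ (λ x → 𝟙 (x ≟ a) + 𝟙 (x ∈? xs))            ≡⟨ ∑-distrib-+ (λ x → 𝟙 (x ≟ a)) (λ x → 𝟙 (x ∈? xs)) ⟩
      ∑ (λ x → 𝟙 (x ≟ a)) + ∑ (λ x → 𝟙 (x ∈? xs))  ≡⟨ cong₂ _+_ (∑-𝟙≡ a) (∑-𝟙∈ unique) ⟩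
      suc (length xs)                              ∎
      where open ≡-Reasoning

-- Finite fields

module FieldProperties (K : FiniteField) where
  open FiniteField K public renaming (_+_ to _⊕_; _*_ to _⊗_; -_ to ⊖_; _^_ to _^ᶠ_)
  module R = IsCommutativeRing isCommutativeRing
  open EnumeratedSum enum public
  open WithDecidableEquality _≟_ public
  open ≡-Reasoning

  ⊕-commutativeSemigroup ⊗-commutativeSemigroup : CommutativeSemigroup 0ℓ 0ℓ
  ⊕-commutativeSemigroup = record { isCommutativeSemigroup = R.+-isCommutativeSemigroup }
  ⊗-commutativeSemigroup = record { isCommutativeSemigroup = R.*-isCommutativeSemigroup }

  ⊗-commutativeMonoid : CommutativeMonoid 0ℓ 0ℓ
  ⊗-commutativeMonoid = record { isCommutativeMonoid = R.*-isCommutativeMonoid }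

  open CommutativeSemigroupProperties ⊕-commutativeSemigroup public using () renaming (x∙yz≈y∙xz to ⊕-x∙yz≈y∙xz)
  open CommutativeSemigroupProperties ⊗-commutativeSemigroup public
    using () renaming (x∙yz≈y∙xz to ⊗-x∙yz≈y∙xz; interchange to ⊗-interchange)

  q : ℕ
  q = size

  ∃? : ∀ {P : F → Set} → (∀ x → Dec (P x)) → Dec (∃ P)
  ∃? {P} P? = map′ (λ (i , p) → from i , p) (λ (x , p) → to x , subst P (sym (from∘to x)) p) (Finₚ.any? (P? ∘ from))
    where open Inverse enum using (to; from) renaming (strictlyInverseʳ to from∘to)

  1≢0 : 1# ≢ 0#
  1≢0 = 0≢1 ∘ sym

  inverseˡ : ∀ x (x≢0 : x ≢ 0#) → inv x x≢0 ⊗ x ≡ 1#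
  inverseˡ x x≢0 = trans (R.*-comm _ x) (inv-r x x≢0)

  inv-cancelˡ : ∀ {a} (a≢0 : a ≢ 0#) x → inv a a≢0 ⊗ (a ⊗ x) ≡ x
  inv-cancelˡ {a} a≢0 x = begin
    inv a a≢0 ⊗ (a ⊗ x)  ≡⟨ R.*-assoc _ a x ⟨
    inv a a≢0 ⊗ a ⊗ x    ≡⟨ cong (_⊗ x) (inverseˡ a a≢0) ⟩
    1# ⊗ x               ≡⟨ R.*-identityˡ x ⟩
    x                    ∎

  inv-cancelʳ : ∀ {a} (a≢0 : a ≢ 0#) x → a ⊗ (inv a a≢0 ⊗ x) ≡ x
  inv-cancelʳ {a} a≢0 x = begin
    a ⊗ (inv a a≢0 ⊗ x)  ≡⟨ R.*-assoc a _ x ⟨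
    a ⊗ inv a a≢0 ⊗ x    ≡⟨ cong (_⊗ x) (inv-r a a≢0) ⟩
    1# ⊗ x               ≡⟨ R.*-identityˡ x ⟩
    x                    ∎

  *-cancelˡ : ∀ {a x y} → a ≢ 0# → a ⊗ x ≡ a ⊗ y → x ≡ y
  *-cancelˡ {a} {x} {y} a≢0 ax≡ay = begin
    x                      ≡⟨ inv-cancelˡ a≢0 x ⟨
    inv a a≢0 ⊗ (a ⊗ x)    ≡⟨ cong (inv a a≢0 ⊗_) ax≡ay ⟩
    inv a a≢0 ⊗ (a ⊗ y)    ≡⟨ inv-cancelˡ a≢0 y ⟩
    y                      ∎

  *-≢0 : ∀ {a b} → a ≢ 0# → b ≢ 0# → a ⊗ b ≢ 0#
  *-≢0 {a} a≢0 b≢0 ab≡0 = b≢0 (*-cancelˡ a≢0 (trans ab≡0 (sym (R.zeroʳ a))))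

  inv-≢0 : ∀ x (x≢0 : x ≢ 0#) → inv x x≢0 ≢ 0#
  inv-≢0 x x≢0 x⁻¹≡0 = 0≢1 (begin
    0#                ≡⟨ R.zeroˡ x ⟨
    0# ⊗ x            ≡⟨ cong (_⊗ x) x⁻¹≡0 ⟨
    inv x x≢0 ⊗ x     ≡⟨ inverseˡ x x≢0 ⟩
    1#                ∎)

  [x⊖y]⊕y≡x : ∀ x y → (x ⊕ ⊖ y) ⊕ y ≡ x
  [x⊖y]⊕y≡x x y = trans (R.+-assoc x (⊖ y) y) (trans (cong (x ⊕_) (R.-‿inverseˡ y)) (R.+-identityʳ x))

  [x⊕y]⊖y≡x : ∀ x y → (x ⊕ y) ⊕ ⊖ y ≡ x
  [x⊕y]⊖y≡x x y = trans (R.+-assoc x y (⊖ y)) (trans (cong (x ⊕_) (R.-‿inverseʳ y)) (R.+-identityʳ x))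

  x⊖y≡0⇒x≡y : ∀ {x y} → x ⊕ ⊖ y ≡ 0# → x ≡ y
  x⊖y≡0⇒x≡y {x} {y} x⊖y≡0 = begin
    x                ≡⟨ [x⊖y]⊕y≡x x y ⟨
    (x ⊕ ⊖ y) ⊕ y    ≡⟨ cong (_⊕ y) x⊖y≡0 ⟩
    0# ⊕ y           ≡⟨ R.+-identityˡ y ⟩
    y                ∎

  ^-+ : ∀ x m n → x ^ᶠ (m + n) ≡ x ^ᶠ m ⊗ x ^ᶠ n
  ^-+ x zero n = sym (R.*-identityˡ _)
  ^-+ x (suc m) n = trans (cong (x ⊗_) (^-+ x m n)) (sym (R.*-assoc x _ _))

  *-^ : ∀ x y n → (x ⊗ y) ^ᶠ n ≡ x ^ᶠ n ⊗ y ^ᶠ n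
  *-^ x y zero = sym (R.*-identityˡ 1#)
  *-^ x y (suc n) = trans (cong ((x ⊗ y) ⊗_) (*-^ x y n)) (⊗-interchange x y _ _)

  ^-* : ∀ x m n → (x ^ᶠ m) ^ᶠ n ≡ x ^ᶠ (m * n)
  ^-* x m zero = cong (x ^ᶠ_) (sym (*-zeroʳ m))
  ^-* x m (suc n) = begin
    x ^ᶠ m ⊗ (x ^ᶠ m) ^ᶠ n    ≡⟨ cong (x ^ᶠ m ⊗_) (^-* x m n) ⟩
    x ^ᶠ m ⊗ x ^ᶠ (m * n)     ≡⟨ ^-+ x m (m * n) ⟨
    x ^ᶠ (m + m * n)          ≡⟨ cong (x ^ᶠ_) (*-suc m n) ⟨
    x ^ᶠ (m * suc n)          ∎

  1^ : ∀ n → 1# ^ᶠ n ≡ 1#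
  1^ zero = refl
  1^ (suc n) = trans (R.*-identityˡ _) (1^ n)

  ^-≢0 : ∀ {x} n → x ≢ 0# → x ^ᶠ n ≢ 0#
  ^-≢0 zero x≢0 = 1≢0
  ^-≢0 (suc n) x≢0 = *-≢0 x≢0 (^-≢0 n x≢0)

  ∑-affine : ∀ (f : F → ℕ) {a} c → a ≢ 0# → ∑ (λ x → f (a ⊗ x ⊕ c)) ≡ ∑ f
  ∑-affine f {a} c a≢0 = ∑-reindex (mk↔ₛ′ (λ x → a ⊗ x ⊕ c) (λ y → inv a a≢0 ⊗ (y ⊕ ⊖ c)) section retraction) f
    where
    section : ∀ y → a ⊗ (inv a a≢0 ⊗ (y ⊕ ⊖ c)) ⊕ c ≡ y
    section y = trans (cong (_⊕ c) (inv-cancelʳ a≢0 _)) ([x⊖y]⊕y≡x y c)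
    retraction : ∀ x → inv a a≢0 ⊗ ((a ⊗ x ⊕ c) ⊕ ⊖ c) ≡ x
    retraction x = trans (cong (inv a a≢0 ⊗_) ([x⊕y]⊖y≡x _ c)) (inv-cancelˡ a≢0 x)

  ∑-scale : ∀ (f : F → ℕ) {a} → a ≢ 0# → ∑ (λ x → f (x ⊗ a)) ≡ ∑ f
  ∑-scale f {a} a≢0 = trans (∑-cong (λ x → cong f (trans (R.*-comm x a) (sym (R.+-identityʳ _))))) (∑-affine f 0# a≢0)

  𝟙≢0 𝟙≡0 : F → ℕ
  𝟙≢0 x = 𝟙 (¬? (x ≟ 0#))
  𝟙≡0 x = 𝟙 (x ≟ 0#)

  N : ℕ
  N = ∑ 𝟙≢0

  suc-N≡q : suc N ≡ q
  suc-N≡q = begin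
    1 + ∑ 𝟙≢0                         ≡⟨ cong (1 +_) (∑-cong (λ x → *-identityʳ (𝟙≢0 x))) ⟨
    1 + ∑ (λ x → 𝟙≢0 x * 1)           ≡⟨ ∑-split 0# (λ _ → 1) ⟨
    ∑ (λ _ → 1)                       ≡⟨ ∑-const 1 ⟩
    q * 1                             ≡⟨ *-identityʳ q ⟩
    q                                 ∎

  𝟙≢0-* : ∀ (f : F → ℕ) → f 0# ≡ 0 → ∀ x → 𝟙≢0 x * f x ≡ f x
  𝟙≢0-* f f0≡0 x with x ≟ 0#
  ... | yes refl = sym f0≡0
  ... | no _ = +-identityʳ _

  ∑-cauchy-schwarz-units : ∀ (f : F → ℕ) → f 0# ≡ 0 → ∑ f * ∑ f ≤ N * ∑ (λ x → f x * f x)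
  ∑-cauchy-schwarz-units f f0≡0 =
    subst₂ (λ S S² → S * S ≤ N * S²) (∑-cong (𝟙≢0-* f f0≡0)) (∑-cong (𝟙≢0-* (λ x → f x * f x) (cong (λ y → y * y) f0≡0)))
           (∑-cauchy-schwarz 𝟙≢0 f)

  1≤N : 1 ≤ N
  1≤N = subst (_≤ N) (𝟙-yes (¬? (1# ≟ 0#)) 1≢0) (term≤∑ 1# 𝟙≢0)

  nonzero-enumeration : Σ (Fin N → F) λ xs → Injective _≡_ _≡_ xs × (∀ i → xs i ≢ 0#)
  nonzero-enumeration = xs , xs-injective , xs-≢0
    where
    open Inverse (subst (λ k → F ↔ Fin k) (sym suc-N≡q) enum) using (to; from) renaming (strictlyInverseˡ to to∘from)
    xs : Fin N → F
    xs i = from (punchIn (to 0#) i)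
    xs-injective : Injective _≡_ _≡_ xs
    xs-injective xsᵢ≡xsⱼ = Finₚ.punchIn-injective (to 0#) _ _ (trans (sym (to∘from _)) (trans (cong to xsᵢ≡xsⱼ) (to∘from _)))
    xs-≢0 : ∀ i → xs i ≢ 0#
    xs-≢0 i xsᵢ≡0 = Finₚ.punchInᵢ≢i (to 0#) i (trans (sym (to∘from _)) (cong to xsᵢ≡0))

  ∑-𝟙≡0-affineˡ : ∀ {a} c → a ≢ 0# → ∑ (λ y → 𝟙≡0 (a ⊗ y ⊕ c)) ≡ 1
  ∑-𝟙≡0-affineˡ c a≢0 = trans (∑-affine 𝟙≡0 c a≢0) (∑-𝟙≡ 0#)

  ∑-𝟙≡0-affineʳ : ∀ {a} c → a ≢ 0# → ∑ (λ y → 𝟙≡0 (y ⊗ a ⊕ c)) ≡ 1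
  ∑-𝟙≡0-affineʳ {a} c a≢0 = trans (∑-cong (λ y → cong (λ z → 𝟙≡0 (z ⊕ c)) (R.*-comm y a))) (∑-𝟙≡0-affineˡ c a≢0)

module Fermat (K : FiniteField) where
  open FieldProperties K
  open ≡-Reasoning

  open import Algebra.Properties.CommutativeMonoid.Sum ⊗-commutativeMonoid using () renaming (sum to product)
  open EnumeratedFold ⊗-commutativeMonoid enum
    renaming (fold to ∏; fold-cong to ∏-cong; fold-distrib to ∏-distrib; fold-reindex to ∏-reindex)

  private
    product-^ : ∀ {k} y (e : Fin k → ℕ) → product (λ i → y ^ᶠ e i) ≡ y ^ᶠ Fin∑.sum e
    product-^ {zero} y e = refl
    product-^ {suc k} y e = trans (cong (y ^ᶠ e zero ⊗_) (product-^ y (e ∘ suc))) (sym (^-+ y (e zero) _))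

    product-≢0 : ∀ {k} (f : Fin k → F) → (∀ i → f i ≢ 0#) → product f ≢ 0#
    product-≢0 {zero} f f≢0 = 1≢0
    product-≢0 {suc k} f f≢0 = *-≢0 (f≢0 zero) (product-≢0 (f ∘ suc) (f≢0 ∘ suc))

  ∏-^ : ∀ y (e : F → ℕ) → ∏ (λ x → y ^ᶠ e x) ≡ y ^ᶠ ∑ e
  ∏-^ y e = product-^ y (e ∘ Inverse.from enum)

  ∏-≢0 : ∀ (f : F → F) → (∀ x → f x ≢ 0#) → ∏ f ≢ 0#
  ∏-≢0 f f≢0 = product-≢0 (f ∘ Inverse.from enum) (f≢0 ∘ Inverse.from enum)

  nonzeroOr1 : F → F
  nonzeroOr1 y with y ≟ 0#
  ... | yes _ = 1#
  ... | no _ = y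

  nonzeroOr1-≢0 : ∀ y → nonzeroOr1 y ≢ 0#
  nonzeroOr1-≢0 y with y ≟ 0#
  ... | yes _ = 1≢0
  ... | no y≢0 = y≢0

  nonzeroOr1-* : ∀ {x} y → x ≢ 0# → nonzeroOr1 (x ⊗ y) ≡ x ^ᶠ 𝟙≢0 y ⊗ nonzeroOr1 y
  nonzeroOr1-* {x} y x≢0 with y ≟ 0# | (x ⊗ y) ≟ 0#
  ... | yes _ | yes _ = sym (R.*-identityˡ 1#)
  ... | yes refl | no xy≢0 = ⊥-elim (xy≢0 (R.zeroʳ x))
  ... | no y≢0 | yes xy≡0 = ⊥-elim (*-≢0 x≢0 y≢0 xy≡0)
  ... | no _ | no _ = cong (_⊗ y) (sym (R.*-identityʳ x))

  -- y ↦ x y permutes F and multiplies exactly the N nonzero factors of ∏ nonzeroOr1 by x.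
  fermat : ∀ {x} → x ≢ 0# → x ^ᶠ N ≡ 1#
  fermat {x} x≢0 = *-cancelˡ (∏-≢0 nonzeroOr1 nonzeroOr1-≢0) (begin
    P ⊗ x ^ᶠ N                                  ≡⟨ R.*-comm P _ ⟩
    x ^ᶠ N ⊗ P                                  ≡⟨ cong (_⊗ P) (∏-^ x 𝟙≢0) ⟨
    ∏ (λ y → x ^ᶠ 𝟙≢0 y) ⊗ P                    ≡⟨ ∏-distrib (λ y → x ^ᶠ 𝟙≢0 y) nonzeroOr1 ⟨
    ∏ (λ y → x ^ᶠ 𝟙≢0 y ⊗ nonzeroOr1 y)         ≡⟨ ∏-cong (λ y → nonzeroOr1-* y x≢0) ⟨
    ∏ (λ y → nonzeroOr1 (x ⊗ y))                ≡⟨ ∏-reindex (mk↔ₛ′ (x ⊗_) (inv x x≢0 ⊗_) (inv-cancelʳ x≢0) (inv-cancelˡ x≢0)) nonzeroOr1 ⟩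
    P                                           ≡⟨ R.*-identityʳ P ⟨
    P ⊗ 1#                                      ∎)
    where
    P = ∏ nonzeroOr1

module Polynomials (K : FiniteField) where
  open FieldProperties K
  open ≡-Reasoning

  eval : List F → F → F
  eval [] x = 0#
  eval (c ∷ p) x = c ⊕ x ⊗ eval p x

  quotient : List F → F → List F
  quotient [] r = []
  quotient (c ∷ []) r = []
  quotient (c ∷ c′ ∷ p) r = eval (c′ ∷ p) r ∷ quotient (c′ ∷ p) r

  length-quotient : ∀ p r → length (quotient p r) ≡ length p ∸ 1
  length-quotient [] r = refl
  length-quotient (c ∷ []) r = refl
  length-quotient (c ∷ c′ ∷ p) r = cong suc (length-quotient (c′ ∷ p) r)

  private
    division-step : ∀ c x r P Q → c ⊕ x ⊗ ((x ⊕ ⊖ r) ⊗ Q ⊕ P) ≡ (x ⊕ ⊖ r) ⊗ (P ⊕ x ⊗ Q) ⊕ (c ⊕ r ⊗ P)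
    division-step c x r P Q = begin
      c ⊕ x ⊗ ((x ⊕ ⊖ r) ⊗ Q ⊕ P)                      ≡⟨ cong (c ⊕_) (R.distribˡ x _ P) ⟩
      c ⊕ (x ⊗ ((x ⊕ ⊖ r) ⊗ Q) ⊕ x ⊗ P)                ≡⟨ cong (λ z → c ⊕ (xrQ ⊕ z ⊗ P)) ([x⊖y]⊕y≡x x r) ⟨
      c ⊕ (xrQ ⊕ ((x ⊕ ⊖ r) ⊕ r) ⊗ P)                  ≡⟨ cong (λ z → c ⊕ (xrQ ⊕ z)) (R.distribʳ P _ r) ⟩
      c ⊕ (xrQ ⊕ ((x ⊕ ⊖ r) ⊗ P ⊕ r ⊗ P))              ≡⟨ +-rearrange c xrQ ((x ⊕ ⊖ r) ⊗ P) (r ⊗ P) ⟩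
      ((x ⊕ ⊖ r) ⊗ P ⊕ xrQ) ⊕ (c ⊕ r ⊗ P)              ≡⟨ cong (λ z → ((x ⊕ ⊖ r) ⊗ P ⊕ z) ⊕ (c ⊕ r ⊗ P)) (⊗-x∙yz≈y∙xz x (x ⊕ ⊖ r) Q) ⟩
      ((x ⊕ ⊖ r) ⊗ P ⊕ (x ⊕ ⊖ r) ⊗ (x ⊗ Q)) ⊕ (c ⊕ r ⊗ P) ≡⟨ cong (_⊕ (c ⊕ r ⊗ P)) (R.distribˡ (x ⊕ ⊖ r) P (x ⊗ Q)) ⟨
      (x ⊕ ⊖ r) ⊗ (P ⊕ x ⊗ Q) ⊕ (c ⊕ r ⊗ P)            ∎
      where
      xrQ = x ⊗ ((x ⊕ ⊖ r) ⊗ Q)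
      +-rearrange : ∀ a b e f → a ⊕ (b ⊕ (e ⊕ f)) ≡ (e ⊕ b) ⊕ (a ⊕ f)
      +-rearrange a b e f = trans (cong (a ⊕_) (⊕-x∙yz≈y∙xz b e f))
                                  (trans (⊕-x∙yz≈y∙xz a e (b ⊕ f))
                                         (trans (cong (e ⊕_) (⊕-x∙yz≈y∙xz a b f)) (sym (R.+-assoc e b (a ⊕ f)))))

  eval-quotient : ∀ p r x → eval p x ≡ (x ⊕ ⊖ r) ⊗ eval (quotient p r) x ⊕ eval p r
  eval-quotient [] r x = sym (trans (cong (_⊕ 0#) (R.zeroʳ _)) (R.+-identityʳ 0#))
  eval-quotient (c ∷ []) r x = begin
    c ⊕ x ⊗ 0#                       ≡⟨ cong (c ⊕_) (trans (R.zeroʳ x) (sym (R.zeroʳ r))) ⟩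
    c ⊕ r ⊗ 0#                       ≡⟨ R.+-identityˡ _ ⟨
    0# ⊕ (c ⊕ r ⊗ 0#)                ≡⟨ cong (_⊕ (c ⊕ r ⊗ 0#)) (R.zeroʳ _) ⟨
    (x ⊕ ⊖ r) ⊗ 0# ⊕ (c ⊕ r ⊗ 0#)    ∎
  eval-quotient (c ∷ c′ ∷ p) r x = begin
    c ⊕ x ⊗ eval (c′ ∷ p) x            ≡⟨ cong (λ z → c ⊕ x ⊗ z) (eval-quotient (c′ ∷ p) r x) ⟩
    c ⊕ x ⊗ ((x ⊕ ⊖ r) ⊗ Q ⊕ P)        ≡⟨ division-step c x r P Q ⟩
    (x ⊕ ⊖ r) ⊗ (P ⊕ x ⊗ Q) ⊕ (c ⊕ r ⊗ P) ∎
    where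
    P = eval (c′ ∷ p) r
    Q = eval (quotient (c′ ∷ p) r) x

  quotient-zero⇒zero : ∀ p r → All (_≡ 0#) (quotient p r) → eval p r ≡ 0# → All (_≡ 0#) p
  quotient-zero⇒zero [] r _ _ = All.[]
  quotient-zero⇒zero (c ∷ []) r _ c+r0≡0 =
    trans (sym (R.+-identityʳ c)) (trans (cong (c ⊕_) (sym (R.zeroʳ r))) c+r0≡0) All.∷ All.[]
  quotient-zero⇒zero (c ∷ c′ ∷ p) r (P≡0 All.∷ quotient-zero) c+rP≡0 =
    trans (sym (R.+-identityʳ c)) (trans (cong (c ⊕_) (sym (trans (cong (r ⊗_) P≡0) (R.zeroʳ r)))) c+rP≡0)
      All.∷ quotient-zero⇒zero (c′ ∷ p) r quotient-zero P≡0

  monomial : ℕ → List F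
  monomial zero = 1# ∷ []
  monomial (suc j) = 0# ∷ monomial j

  length-monomial : ∀ j → length (monomial j) ≡ suc j
  length-monomial zero = refl
  length-monomial (suc j) = cong suc (length-monomial j)

  eval-monomial : ∀ j x → eval (monomial j) x ≡ x ^ᶠ j
  eval-monomial zero x = trans (cong (1# ⊕_) (R.zeroʳ x)) (R.+-identityʳ 1#)
  eval-monomial (suc j) x = trans (R.+-identityˡ _) (cong (x ⊗_) (eval-monomial j x))

  monomial-≢0 : ∀ j → ¬ All (_≡ 0#) (monomial j)
  monomial-≢0 zero (1≡0 All.∷ _) = 1≢0 1≡0
  monomial-≢0 (suc j) (_ All.∷ rest) = monomial-≢0 j rest

  roots⇒zero : ∀ s (p : List F) → length p ≤ s → (xs : Fin s → F) → Injective _≡_ _≡_ xs →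
               (∀ i → eval p (xs i) ≡ 0#) → All (_≡ 0#) p
  roots⇒zero zero [] _ _ _ _ = All.[]
  roots⇒zero (suc s) p length≤ xs xs-injective vanish =
    quotient-zero⇒zero p r (roots⇒zero s (quotient p r) length-Q≤ (xs ∘ suc) (Finₚ.suc-injective ∘ xs-injective) Q-vanishes)
                       (vanish zero)
    where
    r = xs zero
    length-Q≤ : length (quotient p r) ≤ s
    length-Q≤ = subst (_≤ s) (sym (length-quotient p r)) (∸-monoˡ-≤ 1 length≤)
    Q-vanishes : ∀ i → eval (quotient p r) (xs (suc i)) ≡ 0#
    Q-vanishes i with eval (quotient p r) (xs (suc i)) ≟ 0#
    ... | yes Q≡0 = Q≡0
    ... | no Q≢0 = ⊥-elim (*-≢0 x⊖r≢0 Q≢0 (begin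
      (x ⊕ ⊖ r) ⊗ eval (quotient p r) x                    ≡⟨ R.+-identityʳ _ ⟨
      (x ⊕ ⊖ r) ⊗ eval (quotient p r) x ⊕ 0#               ≡⟨ cong ((x ⊕ ⊖ r) ⊗ eval (quotient p r) x ⊕_) (vanish zero) ⟨
      (x ⊕ ⊖ r) ⊗ eval (quotient p r) x ⊕ eval p r         ≡⟨ eval-quotient p r x ⟨
      eval p x                                             ≡⟨ vanish (suc i) ⟩
      0#                                                   ∎))
      where
      x = xs (suc i)
      x⊖r≢0 : x ⊕ ⊖ r ≢ 0#
      x⊖r≢0 = (λ ()) ∘ xs-injective ∘ x⊖y≡0⇒x≡y

-- d-th power residues

module PowerResidues (K : FiniteField) (d : ℕ) where
  open FieldProperties K

  Residue : F → Set
  Residue = InS d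

  residue? : ∀ z → Dec (Residue z)
  residue? z = ∃? (λ x → ¬? (x ≟ 0#) ×-dec ((x ^ᶠ d) ≟ z))

  χ : F → ℕ
  χ z = 𝟙 (residue? z)

  h : ℕ
  h = ∑ χ

  residue-≢0 : ∀ {z} → Residue z → z ≢ 0#
  residue-≢0 (x , x≢0 , xᵈ≡z) z≡0 = ^-≢0 d x≢0 (trans xᵈ≡z z≡0)

  residue-1 : Residue 1#
  residue-1 = 1# , 1≢0 , 1^ d

  residue-* : ∀ {a b} → Residue a → Residue b → Residue (a ⊗ b)
  residue-* (x , x≢0 , xᵈ≡a) (y , y≢0 , yᵈ≡b) = x ⊗ y , *-≢0 x≢0 y≢0 , trans (*-^ x y d) (cong₂ _⊗_ xᵈ≡a yᵈ≡b)

  residue-÷ : ∀ {t u} → Residue u → Residue (t ⊗ u) → Residue t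
  residue-÷ {t} {u} (y , y≢0 , yᵈ≡u) (z , z≢0 , zᵈ≡tu) = z ⊗ y⁻¹ , *-≢0 z≢0 (inv-≢0 y y≢0) , (begin
    (z ⊗ y⁻¹) ^ᶠ d                 ≡⟨ *-^ z y⁻¹ d ⟩
    z ^ᶠ d ⊗ y⁻¹ ^ᶠ d              ≡⟨ cong (_⊗ y⁻¹ ^ᶠ d) zᵈ≡tu ⟩
    t ⊗ u ⊗ y⁻¹ ^ᶠ d               ≡⟨ R.*-assoc t u _ ⟩
    t ⊗ (u ⊗ y⁻¹ ^ᶠ d)             ≡⟨ cong (λ w → t ⊗ (w ⊗ y⁻¹ ^ᶠ d)) yᵈ≡u ⟨
    t ⊗ (y ^ᶠ d ⊗ y⁻¹ ^ᶠ d)        ≡⟨ cong (t ⊗_) (*-^ y y⁻¹ d) ⟨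
    t ⊗ (y ⊗ y⁻¹) ^ᶠ d             ≡⟨ cong (λ w → t ⊗ w ^ᶠ d) (inv-r y y≢0) ⟩
    t ⊗ 1# ^ᶠ d                    ≡⟨ cong (t ⊗_) (1^ d) ⟩
    t ⊗ 1#                         ≡⟨ R.*-identityʳ t ⟩
    t                              ∎)
    where
    open ≡-Reasoning
    y⁻¹ = inv y y≢0

  χ-*-residue : ∀ {u} → Residue u → ∀ t → χ (t ⊗ u) ≡ χ t
  χ-*-residue u-res t with residue? t
  ... | yes t-res = 𝟙-yes (residue? _) (residue-* t-res u-res)
  ... | no ¬t-res = 𝟙-no (residue? _) (¬t-res ∘ residue-÷ u-res)

  χ-idem : ∀ z → χ z * χ z ≡ χ z
  χ-idem z = 𝟙-idem (residue? z)

  χ-0 : χ 0# ≡ 0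
  χ-0 = 𝟙-no (residue? 0#) (λ res → residue-≢0 res refl)

  ∑-χ-scale : ∀ u → ∑ (λ t → χ (t ⊗ u)) ≡ h * 𝟙≢0 u
  ∑-χ-scale u with u ≟ 0#
  ... | yes refl = trans (∑-zero (λ t → trans (cong χ (R.zeroʳ t)) χ-0)) (sym (*-zeroʳ h))
  ... | no u≢0 = trans (∑-scale χ u≢0) (sym (*-identityʳ h))

  1≤h : 1 ≤ h
  1≤h = subst (_≤ h) (𝟙-yes (residue? 1#) residue-1) (term≤∑ 1# χ)

  ResidueOrZero : F → Set
  ResidueOrZero u = Residue u ⊎ u ≡ 0#

  χ-*-residue-or-zero : ∀ {u} → ResidueOrZero u → ∀ t → χ (t ⊗ u) ≡ 𝟙≢0 u * χ t
  χ-*-residue-or-zero {u} (inj₁ u-res) t =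
    trans (χ-*-residue u-res t) (sym (trans (cong (_* χ t) (𝟙-yes (¬? (u ≟ 0#)) (residue-≢0 u-res))) (*-identityˡ (χ t))))
  χ-*-residue-or-zero (inj₂ refl) t =
    trans (cong χ (R.zeroʳ t)) (trans χ-0 (sym (cong (_* χ t) (𝟙-no (¬? (0# ≟ 0#)) (λ 0≢0 → 0≢0 refl)))))

  -- If every unit were a d-th power, with N = k d every unit would be a root of X^k − 1,
  -- whose k + 1 ≤ N coefficients would then all vanish.
  some-unit-is-not-residue : 2 ≤ d → d ∣ N → ¬ (∀ x → x ≢ 0# → Residue x)
  some-unit-is-not-residue 2≤d (divides zero N≡0) _ = <⇒≱ 1≤N (≤-reflexive N≡0)
  some-unit-is-not-residue 2≤d (divides (suc j) N≡k*d) every-residue =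
    monomial-≢0 j (All.tail (roots⇒zero N (⊖ 1# ∷ monomial j) length≤N xs xs-injective vanish))
    where
    open Polynomials K using (eval; monomial; length-monomial; eval-monomial; monomial-≢0; roots⇒zero)
    xs = proj₁ nonzero-enumeration
    xs-injective = proj₁ (proj₂ nonzero-enumeration)
    xs-≢0 = proj₂ (proj₂ nonzero-enumeration)
    length≤N : length (⊖ 1# ∷ monomial j) ≤ N
    length≤N = begin
      suc (length (monomial j))   ≡⟨ cong suc (length-monomial j) ⟩
      suc (suc j)                 ≤⟨ s≤s (s≤s (m≤m*n j 2)) ⟩
      suc j * 2                   ≤⟨ *-monoʳ-≤ (suc j) 2≤d ⟩
      suc j * d                   ≡⟨ N≡k*d ⟨
      N                           ∎
      where open ≤-Reasoning
    root-of-unity : ∀ {x} → x ≢ 0# → x ^ᶠ suc j ≡ 1#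
    root-of-unity x≢0 with every-residue _ x≢0
    ... | y , y≢0 , refl = trans (^-* y d (suc j)) (trans (cong (y ^ᶠ_) (trans (*-comm d (suc j)) (sym N≡k*d))) (Fermat.fermat K y≢0))
    vanish : ∀ i → eval (⊖ 1# ∷ monomial j) (xs i) ≡ 0#
    vanish i = begin
      ⊖ 1# ⊕ xs i ⊗ eval (monomial j) (xs i)   ≡⟨ cong (λ z → ⊖ 1# ⊕ xs i ⊗ z) (eval-monomial j (xs i)) ⟩
      ⊖ 1# ⊕ xs i ^ᶠ suc j                     ≡⟨ cong (⊖ 1# ⊕_) (root-of-unity (xs-≢0 i)) ⟩
      ⊖ 1# ⊕ 1#                                ≡⟨ R.-‿inverseˡ 1# ⟩
      0#                                       ∎
      where open ≡-Reasoning

  non-residue : 2 ≤ d → d ∣ N → ∃ λ g → g ≢ 0# × ¬ Residue g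
  non-residue 2≤d d∣N with ∃? (λ g → ¬? (g ≟ 0#) ×-dec ¬? (residue? g))
  ... | yes found = found
  ... | no none = ⊥-elim (some-unit-is-not-residue 2≤d d∣N every-residue)
    where
    every-residue : ∀ x → x ≢ 0# → Residue x
    every-residue x x≢0 with residue? x
    ... | yes res = res
    ... | no ¬res = ⊥-elim (none (x , x≢0 , ¬res))

  -- H and the coset g H of a non-residue g are disjoint subsets of the units.
  h+h≤N : 2 ≤ d → d ∣ N → h + h ≤ N
  h+h≤N 2≤d d∣N = begin
    h + h                                  ≡⟨ cong (h +_) (*-identityʳ h) ⟨
    h + h * 1                              ≡⟨ cong (λ k → h + h * k) (𝟙-yes (¬? (g ≟ 0#)) g≢0) ⟨
    h + h * 𝟙≢0 g                          ≡⟨ cong (h +_) (∑-χ-scale g) ⟨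
    ∑ χ + ∑ (λ t → χ (t ⊗ g))              ≡⟨ ∑-distrib-+ χ (λ t → χ (t ⊗ g)) ⟨
    ∑ (λ t → χ t + χ (t ⊗ g))              ≤⟨ ∑-mono-≤ disjoint ⟩
    N                                      ∎
    where
    open ≤-Reasoning
    g = proj₁ (non-residue 2≤d d∣N)
    g≢0 = proj₁ (proj₂ (non-residue 2≤d d∣N))
    g-nonres = proj₂ (proj₂ (non-residue 2≤d d∣N))
    disjoint : ∀ t → χ t + χ (t ⊗ g) ≤ 𝟙≢0 t
    disjoint t with t ≟ 0#
    ... | yes refl = ≤-reflexive (cong₂ _+_ χ-0 (trans (cong χ (R.zeroˡ g)) χ-0))
    ... | no _ with residue? t
    ...   | no _ = 𝟙≤1 (residue? (t ⊗ g))
    ...   | yes t-res = ≤-reflexive (cong suc (𝟙-no (residue? (t ⊗ g))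
                          (g-nonres ∘ residue-÷ t-res ∘ subst Residue (R.*-comm t g))))

-- The second-moment argument

square-of-disjoint-indicators : ∀ k {a b} → a * a ≡ a → b * b ≡ b → a * b ≡ 0 →
  (k * a + b) * (k * a + b) ≡ k * k * a + b
square-of-disjoint-indicators k {a} {b} a²≡a b²≡b ab≡0 = begin
  (k * a + b) * (k * a + b)                  ≡⟨ solve (k ∷ a ∷ b ∷ []) ⟩
  k * k * (a * a) + 2 * k * (a * b) + b * b  ≡⟨ cong₂ (λ u v → k * k * u + 2 * k * v + b * b) a²≡a ab≡0 ⟩
  k * k * a + 2 * k * 0 + b * b              ≡⟨ cong₂ (λ u v → k * k * a + u + v) (*-zeroʳ (2 * k)) b²≡b ⟩
  k * k * a + 0 + b                          ≡⟨ cong (_+ b) (+-identityʳ (k * k * a)) ⟩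
  k * k * a + b                              ∎
  where open ≡-Reasoning

two-cosets-arithmetic : ∀ k h r → h ≤ r →
  (k * h + h) * (k * h + h) + (k ∸ 1) * (k ∸ 1) * (h * r) ≤ (h + r) * (k * k * h + h)
two-cosets-arithmetic zero h r h≤r = begin
  (0 + h) * (0 + h) + 0   ≡⟨ +-identityʳ (h * h) ⟩
  h * h                   ≤⟨ m≤m+n (h * h) (r * h) ⟩
  h * h + r * h           ≡⟨ solve (h ∷ r ∷ []) ⟩
  (h + r) * (0 + h)       ∎
  where open ≤-Reasoning
two-cosets-arithmetic (suc j) h r h≤r with m≤n⇒∃[o]m+o≡n h≤r
... | s , refl = begin
  (suc j * h + h) * (suc j * h + h) + j * j * (h * (h + s))                    ≤⟨ m≤m+n _ (2 * suc j * h * s) ⟩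
  (suc j * h + h) * (suc j * h + h) + j * j * (h * (h + s)) + 2 * suc j * h * s ≡⟨ solve (j ∷ h ∷ s ∷ []) ⟩
  (h + (h + s)) * (suc j * suc j * h + h)                                      ∎
  where open ≤-Reasoning

private
  second-moment-core : ∀ {L C X M m h N} →
    h * h * C + L ≤ N * X → m * h * (m * h) ≤ N * M →
    X + M + m * (h * h) ≡ m * (suc N * h) + m * m * (h * h) →
    C + m * (m * 2) + m * suc N ≡ m * suc (suc N) + m * m * suc N →
    L + m * h * h * suc N ≤ N * (m * (suc N * h))
  second-moment-core {L} {C} {X} {M} {m} {h} {N} P1 P2 E1 E2 =
    +-cancelʳ-≤ (N * (m * m * (h * h)) + 2 * (m * m * (h * h))) _ _ (begin
      L + m * h * h * suc N + (N * (m * m * (h * h)) + 2 * (m * m * (h * h)))  ≡⟨ solve (L ∷ m ∷ h ∷ N ∷ []) ⟩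
      L + m * h * (m * h) + N * (m * (h * h)) + h * h * (m * m * suc N + m)   ≡⟨ cong (λ z → L + m * h * (m * h) + N * (m * (h * h)) + h * h * z) E2′ ⟨
      L + m * h * (m * h) + N * (m * (h * h)) + h * h * (C + m * (m * 2))     ≡⟨ solve (L ∷ C ∷ m ∷ h ∷ N ∷ []) ⟩
      h * h * C + L + m * h * (m * h) + N * (m * (h * h)) + h * h * (m * (m * 2)) ≤⟨ +-monoˡ-≤ _ (+-monoˡ-≤ _ (+-mono-≤ P1 P2)) ⟩
      N * X + N * M + N * (m * (h * h)) + h * h * (m * (m * 2))               ≡⟨ solve (X ∷ M ∷ m ∷ h ∷ N ∷ []) ⟩
      N * (X + M + m * (h * h)) + h * h * (m * (m * 2))                       ≡⟨ cong (λ z → N * z + h * h * (m * (m * 2))) E1 ⟩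
      N * (m * (suc N * h) + m * m * (h * h)) + h * h * (m * (m * 2))         ≡⟨ solve (m ∷ h ∷ N ∷ []) ⟩
      N * (m * (suc N * h)) + (N * (m * m * (h * h)) + 2 * (m * m * (h * h))) ∎)
    where
    open ≤-Reasoning
    E2′ : C + m * (m * 2) ≡ m * m * suc N + m
    E2′ = +-cancelʳ-≡ (m * suc N) (C + m * (m * 2)) (m * m * suc N + m) (begin-equality
      C + m * (m * 2) + m * suc N          ≡⟨ E2 ⟩
      m * suc (suc N) + m * m * suc N      ≡⟨ solve (m ∷ N ∷ []) ⟩
      m * m * suc N + m + m * suc N        ∎)

-- The hypotheses are the two Cauchy–Schwarz bounds and the two pair-count identities of the second-moment argument.
second-moment-arithmetic : ∀ {L C X M m h r N q} → q ≡ suc N → N ≡ h + r →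
  h * h * C + L ≤ N * X → m * h * (m * h) ≤ N * M →
  X + M + m * (h * h) ≡ m * (q * h) + m * m * (h * h) →
  C + m * (m * 2) + m * q ≡ m * suc q + m * m * q →
  L ≤ m * h * r * q
second-moment-arithmetic {L} {m = m} {h} {r} refl refl P1 P2 E1 E2 =
  +-cancelˡ-≤ (m * h * h * suc (h + r)) L (m * h * r * suc (h + r)) (begin
    m * h * h * suc (h + r) + L                           ≡⟨ +-comm _ L ⟩
    L + m * h * h * suc (h + r)                           ≤⟨ second-moment-core {m = m} {h} {h + r} P1 P2 E1 E2 ⟩
    (h + r) * (m * (suc (h + r) * h))                     ≡⟨ solve (m ∷ h ∷ r ∷ []) ⟩
    m * h * h * suc (h + r) + m * h * r * suc (h + r)     ∎)
  where open ≤-Reasoning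

m*m+m*k≤m*q⇒m+k≤q : ∀ {m k q} → 1 ≤ m → m * m + m * k ≤ m * q → m + k ≤ q
m*m+m*k≤m*q⇒m+k≤q {m} {k} {q} 1≤m le = *-cancelˡ-≤ m (subst (_≤ m * q) (sym (*-distribˡ-+ m m k)) le)
  where instance _ = >-nonZero 1≤m

private
  2*[1+k]∸1≡1+2*k : ∀ k → 2 * suc k ∸ 1 ≡ suc (2 * k)
  2*[1+k]∸1≡1+2*k k = cong (_∸ 1) double
    where
    double : 2 * suc k ≡ 1 + suc (2 * k)
    double = solve (k ∷ [])

  2*[3+k]∸5≡1+2*k : ∀ k → 2 * (3 + k) ∸ 5 ≡ suc (2 * k)
  2*[3+k]∸5≡1+2*k k = cong (_∸ 5) double
    where
    double : 2 * (3 + k) ≡ 5 + suc (2 * k)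
    double = solve (k ∷ [])

sd-arithmetic : ∀ m q → 1 ≤ q → m * m + m * ((m ∸ 1) * (m ∸ 1)) ≤ m * q → (2 * m ∸ 1) ^ 2 + 3 ≤ 4 * q
sd-arithmetic zero q 1≤q _ = ≤-trans (n≤1+n 3) (*-monoʳ-≤ 4 1≤q)
sd-arithmetic (suc k) q _ le = begin
  (2 * suc k ∸ 1) ^ 2 + 3    ≡⟨ cong (λ n → n ^ 2 + 3) (2*[1+k]∸1≡1+2*k k) ⟩
  suc (2 * k) ^ 2 + 3        ≡⟨ expand ⟩
  4 * (suc k + k * k)        ≤⟨ *-monoʳ-≤ 4 (m*m+m*k≤m*q⇒m+k≤q {suc k} {k * k} {q} (s≤s z≤n) le) ⟩
  4 * q                      ∎
  where
  open ≤-Reasoning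
  expand : suc (2 * k) * (suc (2 * k) * 1) + 3 ≡ 4 * (suc k + k * k)
  expand = solve (k ∷ [])

d-arithmetic : ∀ m q → m * m + m * ((m ∸ 3) * (m ∸ 3)) ≤ m * q → m ≤ 2 ⊎ (2 * m ∸ 5) ^ 2 + 11 ≤ 4 * q
d-arithmetic 0 q _ = inj₁ z≤n
d-arithmetic 1 q _ = inj₁ (s≤s z≤n)
d-arithmetic 2 q _ = inj₁ (s≤s (s≤s z≤n))
d-arithmetic (suc (suc (suc k))) q le = inj₂ (begin
  (2 * (3 + k) ∸ 5) ^ 2 + 11   ≡⟨ cong (λ n → n ^ 2 + 11) (2*[3+k]∸5≡1+2*k k) ⟩
  suc (2 * k) ^ 2 + 11         ≡⟨ expand ⟩
  4 * (3 + k + k * k)          ≤⟨ *-monoʳ-≤ 4 (m*m+m*k≤m*q⇒m+k≤q {3 + k} {k * k} {q} (s≤s z≤n) le) ⟩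
  4 * q                        ∎)
  where
  open ≤-Reasoning
  expand : suc (2 * k) * (suc (2 * k) * 1) + 11 ≡ 4 * (3 + k + k * k)
  expand = solve (k ∷ [])

module Counting (K : FiniteField) (d : ℕ) (2h≤N : PowerResidues.h K d + PowerResidues.h K d ≤ FieldProperties.N K)
                (λ′ : FiniteField.F K) (λ′≢0 : λ′ ≢ FiniteField.0# K)
                (as : List (FiniteField.F K)) (distinct : FiniteField.DistinctNonzero K as) where
  open FieldProperties K
  open PowerResidues K d
  open import Data.List.Membership.DecPropositional _≟_ using (_∈?_)

  r : ℕ
  r = N ∸ h

  N≡h+r : N ≡ h + r
  N≡h+r = sym (m+[n∸m]≡n (≤-trans (m≤m+n h h) 2h≤N))

  h≤r : h ≤ r
  h≤r = +-cancelˡ-≤ h h r (subst (h + h ≤_) N≡h+r 2h≤N)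

  m : ℕ
  m = length as

  α : F → ℕ
  α b = 𝟙 (b ∈? as)

  ∑A : (F → ℕ) → ℕ
  ∑A f = ∑ (λ b → α b * f b)

  α-on : ∀ {f g : F → ℕ} → (∀ {b} → b ∈ as → f b ≡ g b) → ∀ b → α b * f b ≡ α b * g b
  α-on f≡g b with b ∈? as
  ... | yes b∈as = cong (_+ 0) (f≡g b∈as)
  ... | no _ = refl

  ∑A-cong : ∀ {f g : F → ℕ} → (∀ {b} → b ∈ as → f b ≡ g b) → ∑A f ≡ ∑A g
  ∑A-cong f≡g = ∑-cong (α-on f≡g)

  ∑A-mono-≤ : ∀ {f g : F → ℕ} → (∀ {b} → b ∈ as → f b ≤ g b) → ∑A f ≤ ∑A g
  ∑A-mono-≤ f≤g = ∑-mono-≤ pointwise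
    where
    pointwise : ∀ b → α b * _ ≤ α b * _
    pointwise b with b ∈? as
    ... | yes b∈as = +-monoˡ-≤ 0 (f≤g b∈as)
    ... | no _ = z≤n

  ∑A-distrib-+ : ∀ (f g : F → ℕ) → ∑A (λ b → f b + g b) ≡ ∑A f + ∑A g
  ∑A-distrib-+ f g = trans (∑-cong (λ b → *-distribˡ-+ (α b) (f b) (g b))) (∑-distrib-+ (λ b → α b * f b) (λ b → α b * g b))

  ∑A-*ˡ : ∀ k (f : F → ℕ) → ∑A (λ b → k * f b) ≡ k * ∑A f
  ∑A-*ˡ k f = trans (∑-cong (λ b → x∙yz≈y∙xz (α b) k (f b))) (∑-*ˡ k (λ b → α b * f b))

  ∑A-*ʳ : ∀ k (f : F → ℕ) → ∑A (λ b → f b * k) ≡ ∑A f * k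
  ∑A-*ʳ k f = trans (∑-cong (λ b → sym (*-assoc (α b) (f b) k))) (∑-*ʳ k (λ b → α b * f b))

  ∑A≤∑ : ∀ (f : F → ℕ) → ∑A f ≤ ∑ f
  ∑A≤∑ f = ∑-mono-≤ (λ b → subst (α b * f b ≤_) (*-identityˡ (f b)) (*-monoˡ-≤ (f b) (𝟙≤1 (b ∈? as))))

  ∑α≡m : ∑ α ≡ m
  ∑α≡m = ∑-𝟙∈ (proj₁ distinct)

  ∑A-const : ∀ k → ∑A (λ _ → k) ≡ m * k
  ∑A-const k = trans (∑-*ʳ k α) (cong (_* k) ∑α≡m)

  ∑A-split : ∀ {x} → x ∈ as → ∀ (f : F → ℕ) → ∑A f ≡ f x + ∑A (λ b → 𝟙 (¬? (b ≟ x)) * f b)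
  ∑A-split {x} x∈as f = begin
    ∑A f                                                 ≡⟨ ∑-split x (λ b → α b * f b) ⟩
    α x * f x + ∑ (λ b → 𝟙 (¬? (b ≟ x)) * (α b * f b))   ≡⟨ cong₂ _+_ (cong (λ a → a * f x) (𝟙-yes (x ∈? as) x∈as))
                                                                    (∑-cong (λ b → x∙yz≈y∙xz (𝟙 (¬? (b ≟ x))) (α b) (f b))) ⟩
    1 * f x + ∑A (λ b → 𝟙 (¬? (b ≟ x)) * f b)            ≡⟨ cong (_+ ∑A (λ b → 𝟙 (¬? (b ≟ x)) * f b)) (*-identityˡ (f x)) ⟩
    f x + ∑A (λ b → 𝟙 (¬? (b ≟ x)) * f b)                ∎
    where open ≡-Reasoning

  0∉as : ¬ (0# ∈ as)
  0∉as 0∈as = proj₂ distinct 0∈as refl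

  ∑A²-diagonal : ∀ (P : F → F → ℕ) {D O} → (∀ {b} → b ∈ as → P b b ≡ D) →
    (∀ {b b′} → b ∈ as → b′ ∈ as → b ≢ b′ → P b b′ ≡ O) →
    ∑A (λ b → ∑A (λ b′ → P b b′)) + m * O ≡ m * D + m * m * O
  ∑A²-diagonal P {D} {O} diagonal off-diagonal = begin
    ∑A (λ b → ∑A (P b)) + m * O           ≡⟨ cong (∑A (λ b → ∑A (P b)) +_) (∑A-const O) ⟨
    ∑A (λ b → ∑A (P b)) + ∑A (λ _ → O)    ≡⟨ ∑A-distrib-+ (λ b → ∑A (P b)) (λ _ → O) ⟨
    ∑A (λ b → ∑A (P b) + O)               ≡⟨ ∑A-cong row ⟩
    ∑A (λ _ → D + m * O)                  ≡⟨ ∑A-const (D + m * O) ⟩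
    m * (D + m * O)                       ≡⟨ *-distribˡ-+ m D (m * O) ⟩
    m * D + m * (m * O)                   ≡⟨ cong (m * D +_) (*-assoc m m O) ⟨
    m * D + m * m * O                     ∎
    where
    open ≡-Reasoning
    row : ∀ {b} → b ∈ as → ∑A (P b) + O ≡ D + m * O
    row {b} b∈as = begin
      ∑A (P b) + O                                  ≡⟨ cong (_+ O) (∑A-split b∈as (P b)) ⟩
      P b b + ∑A (λ b′ → 𝟙 (¬? (b′ ≟ b)) * P b b′) + O ≡⟨ cong (λ z → z + ∑A (λ b′ → 𝟙 (¬? (b′ ≟ b)) * P b b′) + O) (diagonal b∈as) ⟩
      D + ∑A (λ b′ → 𝟙 (¬? (b′ ≟ b)) * P b b′) + O  ≡⟨ cong (λ z → D + z + O) (∑A-cong others) ⟩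
      D + R + O                                     ≡⟨ +-assoc D R O ⟩
      D + (R + O)                                   ≡⟨ cong (D +_) (+-comm R O) ⟩
      D + (O + R)                                   ≡⟨ cong (D +_) (∑A-split b∈as (λ _ → O)) ⟨
      D + ∑A (λ _ → O)                              ≡⟨ cong (D +_) (∑A-const O) ⟩
      D + m * O                                     ∎
      where
      R = ∑A (λ b′ → 𝟙 (¬? (b′ ≟ b)) * O)
      others : ∀ {b′} → b′ ∈ as → 𝟙 (¬? (b′ ≟ b)) * P b b′ ≡ 𝟙 (¬? (b′ ≟ b)) * O
      others {b′} b′∈as with b′ ≟ b
      ... | yes _ = refl
      ... | no b′≢b = cong (_+ 0) (off-diagonal b∈as b′∈as (b′≢b ∘ sym))

  S : F → F → ℕ
  S x t = ∑A (λ b → χ (t ⊗ (x ⊗ b ⊕ λ′)))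

  nonzeroCount : F → ℕ
  nonzeroCount x = ∑A (λ b → 𝟙≢0 (x ⊗ b ⊕ λ′))

  ∑S≡h*nonzeroCount : ∀ x → ∑ (S x) ≡ h * nonzeroCount x
  ∑S≡h*nonzeroCount x = begin
    ∑ (λ t → ∑A (λ b → χ (t ⊗ (x ⊗ b ⊕ λ′))))   ≡⟨ ∑-weighted-comm α (λ t b → χ (t ⊗ (x ⊗ b ⊕ λ′))) ⟩
    ∑A (λ b → ∑ (λ t → χ (t ⊗ (x ⊗ b ⊕ λ′))))   ≡⟨ ∑-cong (λ b → cong (α b *_) (∑-χ-scale (x ⊗ b ⊕ λ′))) ⟩
    ∑A (λ b → h * 𝟙≢0 (x ⊗ b ⊕ λ′))             ≡⟨ ∑A-*ˡ h (λ b → 𝟙≢0 (x ⊗ b ⊕ λ′)) ⟩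
    h * nonzeroCount x                          ∎
    where open ≡-Reasoning

  S-at-0 : ∀ x → S x 0# ≡ 0
  S-at-0 x = ∑-zero (λ b → trans (cong (λ z → α b * χ z) (R.zeroˡ (x ⊗ b ⊕ λ′))) (trans (cong (α b *_) χ-0) (*-zeroʳ (α b))))

  Deficit : F → ℕ → Set
  Deficit x L = ∑ (S x) * ∑ (S x) + L ≤ N * ∑ (λ t → S x t * S x t)

  deficit-mono : ∀ {x L L′} → L′ ≤ L → Deficit x L → Deficit x L′
  deficit-mono L′≤L = ≤-trans (+-monoʳ-≤ _ L′≤L)

  deficit-0 : ∀ x → Deficit x 0
  deficit-0 x = subst (_≤ N * ∑ (λ t → S x t * S x t)) (sym (+-identityʳ _)) (∑-cauchy-schwarz-units (S x) (S-at-0 x))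

  deficit-scaled-indicator : ∀ {x} k (f : F → ℕ) → (∀ t → f t * f t ≡ f t) → ∑ f ≡ h →
    (∀ t → S x t ≡ k * f t) → Deficit x (k * k * (h * r))
  deficit-scaled-indicator {x} k f f-idem ∑f≡h S≡kf = ≤-reflexive (begin
    ∑ (S x) * ∑ (S x) + k * k * (h * r)                           ≡⟨ cong (λ s → s * s + k * k * (h * r)) ∑S≡∑kf ⟩
    ∑ (λ t → k * f t) * ∑ (λ t → k * f t) + k * k * (h * r)      ≡⟨ ∑-scaled-indicator-square k r f-idem ∑f≡h ⟩
    (h + r) * ∑ (λ t → k * f t * (k * f t))                      ≡⟨ cong₂ _*_ N≡h+r (∑-cong (λ t → cong₂ _*_ (S≡kf t) (S≡kf t))) ⟨
    N * ∑ (λ t → S x t * S x t)                                  ∎)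
    where
    open ≡-Reasoning
    ∑S≡∑kf = ∑-cong S≡kf

  deficit-two-cosets : ∀ {x} k w → (∀ t → S x t ≡ k * χ t + χ (t ⊗ w)) → Deficit x ((k ∸ 1) * (k ∸ 1) * (h * r))
  deficit-two-cosets {x} k w S≡ with w ≟ 0#
  ... | yes refl = deficit-mono (*-monoˡ-≤ (h * r) (*-mono-≤ (m∸n≤m k 1) (m∸n≤m k 1)))
                     (deficit-scaled-indicator k χ χ-idem refl S≡kχ)
    where
    S≡kχ : ∀ t → S x t ≡ k * χ t
    S≡kχ t = trans (S≡ t) (trans (cong (λ z → k * χ t + χ z) (R.zeroʳ t)) (trans (cong (k * χ t +_) χ-0) (+-identityʳ _)))
  ... | no w≢0 with residue? w
  ...   | yes w-res = deficit-mono (*-monoˡ-≤ (h * r) (*-mono-≤ k∸1≤1+k k∸1≤1+k))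
                        (deficit-scaled-indicator (suc k) χ χ-idem refl S≡[1+k]χ)
    where
    k∸1≤1+k = ≤-trans (m∸n≤m k 1) (n≤1+n k)
    S≡[1+k]χ : ∀ t → S x t ≡ suc k * χ t
    S≡[1+k]χ t = trans (S≡ t) (trans (cong (k * χ t +_) (χ-*-residue w-res t)) (+-comm (k * χ t) (χ t)))
  ...   | no w-nonres = subst₂ (λ Σ Σ² → Σ * Σ + (k ∸ 1) * (k ∸ 1) * (h * r) ≤ N * Σ²) (sym ∑S) (sym ∑S²)
                          (subst (λ n → (k * h + h) * (k * h + h) + (k ∸ 1) * (k ∸ 1) * (h * r) ≤ n * (k * k * h + h)) (sym N≡h+r)
                             (two-cosets-arithmetic k h r h≤r))
    where
    disjoint : ∀ t → χ t * χ (t ⊗ w) ≡ 0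
    disjoint t with residue? t
    ... | no _ = refl
    ... | yes t-res = cong (_+ 0) (𝟙-no (residue? (t ⊗ w)) (w-nonres ∘ residue-÷ t-res ∘ subst Residue (R.*-comm t w)))
    S²≡ : ∀ t → S x t * S x t ≡ k * k * χ t + χ (t ⊗ w)
    S²≡ t = trans (cong₂ _*_ (S≡ t) (S≡ t)) (square-of-disjoint-indicators k (χ-idem t) (χ-idem (t ⊗ w)) (disjoint t))
    ∑χw≡h : ∑ (λ t → χ (t ⊗ w)) ≡ h
    ∑χw≡h = trans (∑-χ-scale w) (trans (cong (h *_) (𝟙-yes (¬? (w ≟ 0#)) w≢0)) (*-identityʳ h))
    ∑S : ∑ (S x) ≡ k * h + h
    ∑S = trans (∑-cong S≡) (trans (∑-distrib-+ (λ t → k * χ t) (λ t → χ (t ⊗ w))) (cong₂ _+_ (∑-*ˡ k χ) ∑χw≡h))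
    ∑S² : ∑ (λ t → S x t * S x t) ≡ k * k * h + h
    ∑S² = trans (∑-cong S²≡) (trans (∑-distrib-+ (λ t → k * k * χ t) (λ t → χ (t ⊗ w))) (cong₂ _+_ (∑-*ˡ (k * k) χ) ∑χw≡h))

  deficit-at-0 : Deficit 0# (m * m * (h * r))
  deficit-at-0 = deficit-scaled-indicator m (λ t → χ (t ⊗ λ′)) (λ t → χ-idem (t ⊗ λ′)) ∑χλ≡h S0≡
    where
    ∑χλ≡h : ∑ (λ t → χ (t ⊗ λ′)) ≡ h
    ∑χλ≡h = trans (∑-χ-scale λ′) (trans (cong (h *_) (𝟙-yes (¬? (λ′ ≟ 0#)) λ′≢0)) (*-identityʳ h))
    S0≡ : ∀ t → S 0# t ≡ m * χ (t ⊗ λ′)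
    S0≡ t = trans (∑-cong (λ b → cong (λ z → α b * χ (t ⊗ z)) (trans (cong (_⊕ λ′) (R.zeroˡ b)) (R.+-identityˡ λ′))))
                  (∑A-const (χ (t ⊗ λ′)))

  ∑A² : (F → F → ℕ) → ℕ
  ∑A² P = ∑A (λ b → ∑A (P b))

  ∑A²-distrib-+ : ∀ (P Q : F → F → ℕ) → ∑A² (λ b b′ → P b b′ + Q b b′) ≡ ∑A² P + ∑A² Q
  ∑A²-distrib-+ P Q = trans (∑A-cong (λ {b} _ → ∑A-distrib-+ (P b) (Q b))) (∑A-distrib-+ (λ b → ∑A (P b)) (λ b → ∑A (Q b)))

  jointAffine jointLinear jointPlane jointNonzero : F → F → ℕ
  jointAffine b b′ = ∑ (λ t → ∑ (λ x → χ (t ⊗ (x ⊗ b ⊕ λ′)) * χ (t ⊗ (x ⊗ b′ ⊕ λ′))))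
  jointLinear b b′ = ∑ (λ s → χ (s ⊗ b) * χ (s ⊗ b′))
  jointPlane b b′ = ∑ (λ t → ∑ (λ s → χ (s ⊗ b ⊕ t ⊗ λ′) * χ (s ⊗ b′ ⊕ t ⊗ λ′)))
  jointNonzero b b′ = ∑ (λ x → 𝟙≢0 (x ⊗ b ⊕ λ′) * 𝟙≢0 (x ⊗ b′ ⊕ λ′))

  -- The t = 0 slice of jointPlane is jointLinear; on every other slice s = x t turns it into jointAffine.
  jointAffine+jointLinear≡jointPlane : ∀ b b′ → jointAffine b b′ + jointLinear b b′ ≡ jointPlane b b′
  jointAffine+jointLinear≡jointPlane b b′ = begin
    jointAffine b b′ + jointLinear b b′                          ≡⟨ cong (_+ jointLinear b b′) (∑-split 0# affine) ⟩
    affine 0# + ∑ (λ t → 𝟙≢0 t * affine t) + jointLinear b b′    ≡⟨ cong (λ z → z + ∑ (λ t → 𝟙≢0 t * affine t) + jointLinear b b′) affine-0 ⟩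
    ∑ (λ t → 𝟙≢0 t * affine t) + jointLinear b b′                ≡⟨ +-comm _ (jointLinear b b′) ⟩
    jointLinear b b′ + ∑ (λ t → 𝟙≢0 t * affine t)                ≡⟨ cong₂ _+_ plane-0 (sym (∑-cong slice)) ⟨
    plane 0# + ∑ (λ t → 𝟙≢0 t * plane t)                         ≡⟨ ∑-split 0# plane ⟨
    jointPlane b b′                                              ∎
    where
    open ≡-Reasoning
    affine plane : F → ℕ
    affine t = ∑ (λ x → χ (t ⊗ (x ⊗ b ⊕ λ′)) * χ (t ⊗ (x ⊗ b′ ⊕ λ′)))
    plane t = ∑ (λ s → χ (s ⊗ b ⊕ t ⊗ λ′) * χ (s ⊗ b′ ⊕ t ⊗ λ′))
    affine-0 : affine 0# ≡ 0
    affine-0 = ∑-zero (λ x → cong (_* χ (0# ⊗ (x ⊗ b′ ⊕ λ′))) (trans (cong χ (R.zeroˡ (x ⊗ b ⊕ λ′))) χ-0))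
    plane-0 : plane 0# ≡ jointLinear b b′
    plane-0 = ∑-cong (λ s → cong₂ (λ u v → χ u * χ v) (drop-0 s b) (drop-0 s b′))
      where
      drop-0 : ∀ s c → s ⊗ c ⊕ 0# ⊗ λ′ ≡ s ⊗ c
      drop-0 s c = trans (cong (s ⊗ c ⊕_) (R.zeroˡ λ′)) (R.+-identityʳ _)
    expand : ∀ t x c → t ⊗ (x ⊗ c ⊕ λ′) ≡ (x ⊗ t) ⊗ c ⊕ t ⊗ λ′
    expand t x c = trans (R.distribˡ t (x ⊗ c) λ′)
                         (cong (_⊕ t ⊗ λ′) (trans (sym (R.*-assoc t x c)) (cong (_⊗ c) (R.*-comm t x))))
    slice : ∀ t → 𝟙≢0 t * affine t ≡ 𝟙≢0 t * plane t
    slice t with t ≟ 0#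
    ... | yes _ = refl
    ... | no t≢0 = cong (_+ 0) (trans (∑-cong (λ x → cong₂ (λ u v → χ u * χ v) (expand t x b) (expand t x b′)))
                                      (∑-scale (λ s → χ (s ⊗ b ⊕ t ⊗ λ′) * χ (s ⊗ b′ ⊕ t ⊗ λ′)) t≢0))

  jointPlane-diagonal : ∀ {b} → b ≢ 0# → jointPlane b b ≡ q * h
  jointPlane-diagonal {b} b≢0 = begin
    jointPlane b b                                  ≡⟨ ∑-cong (λ t → ∑-cong (λ s → trans (χ-idem _) (cong (λ z → χ (z ⊕ t ⊗ λ′)) (R.*-comm s b)))) ⟩
    ∑ (λ t → ∑ (λ s → χ (b ⊗ s ⊕ t ⊗ λ′)))          ≡⟨ ∑-cong (λ t → ∑-affine χ (t ⊗ λ′) b≢0) ⟩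
    ∑ (λ _ → h)                                     ≡⟨ ∑-const h ⟩
    q * h                                           ∎
    where open ≡-Reasoning

  -- For fixed s, substituting u = λ t + s b turns the pair into (u, u + s (b′ − b)).
  jointPlane-off-diagonal : ∀ {b b′} → b ≢ b′ → jointPlane b b′ ≡ h * h
  jointPlane-off-diagonal {b} {b′} b≢b′ = begin
    jointPlane b b′                                            ≡⟨ ∑-comm (λ t s → χ (s ⊗ b ⊕ t ⊗ λ′) * χ (s ⊗ b′ ⊕ t ⊗ λ′)) ⟩
    ∑ (λ s → ∑ (λ t → χ (s ⊗ b ⊕ t ⊗ λ′) * χ (s ⊗ b′ ⊕ t ⊗ λ′))) ≡⟨ ∑-cong (λ s → trans (∑-cong (λ t → cong₂ (λ u v → χ u * χ v) (shift s t) (shift′ s t)))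
                                                                                   (∑-affine (λ u → χ u * χ (u ⊕ s ⊗ δ)) (s ⊗ b) λ′≢0)) ⟩
    ∑ (λ s → ∑ (λ u → χ u * χ (u ⊕ s ⊗ δ)))                     ≡⟨ ∑-weighted-comm χ (λ s u → χ (u ⊕ s ⊗ δ)) ⟩
    ∑ (λ u → χ u * ∑ (λ s → χ (u ⊕ s ⊗ δ)))                     ≡⟨ ∑-cong (λ u → cong (χ u *_) (trans (∑-cong (λ s → cong χ (+-comm′ u s))) (∑-affine χ u δ≢0))) ⟩
    ∑ (λ u → χ u * h)                                          ≡⟨ ∑-*ʳ h χ ⟩
    h * h                                                      ∎
    where
    open ≡-Reasoning
    δ = b′ ⊕ ⊖ b
    δ≢0 : δ ≢ 0#
    δ≢0 = b≢b′ ∘ sym ∘ x⊖y≡0⇒x≡y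
    shift : ∀ s t → s ⊗ b ⊕ t ⊗ λ′ ≡ λ′ ⊗ t ⊕ s ⊗ b
    shift s t = trans (R.+-comm _ _) (cong (_⊕ s ⊗ b) (R.*-comm t λ′))
    shift′ : ∀ s t → s ⊗ b′ ⊕ t ⊗ λ′ ≡ (λ′ ⊗ t ⊕ s ⊗ b) ⊕ s ⊗ δ
    shift′ s t = begin
      s ⊗ b′ ⊕ t ⊗ λ′                  ≡⟨ R.+-comm _ _ ⟩
      t ⊗ λ′ ⊕ s ⊗ b′                  ≡⟨ cong₂ _⊕_ (R.*-comm t λ′) (cong (s ⊗_) (trans (sym ([x⊖y]⊕y≡x b′ b)) (R.+-comm δ b))) ⟩
      λ′ ⊗ t ⊕ s ⊗ (b ⊕ δ)             ≡⟨ cong (λ′ ⊗ t ⊕_) (R.distribˡ s b δ) ⟩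
      λ′ ⊗ t ⊕ (s ⊗ b ⊕ s ⊗ δ)         ≡⟨ R.+-assoc _ _ _ ⟨
      (λ′ ⊗ t ⊕ s ⊗ b) ⊕ s ⊗ δ         ∎
    +-comm′ : ∀ u s → u ⊕ s ⊗ δ ≡ δ ⊗ s ⊕ u
    +-comm′ u s = trans (R.+-comm u _) (cong (_⊕ u) (R.*-comm s δ))

  jointNonzero-diagonal : ∀ {b} → b ≢ 0# → jointNonzero b b + 2 ≡ suc q
  jointNonzero-diagonal {b} b≢0 = begin
    jointNonzero b b + 2                                 ≡⟨ cong (λ k → jointNonzero b b + (k + k)) (∑-𝟙≡0-affineʳ λ′ b≢0) ⟨
    jointNonzero b b + (∑ zero-at + ∑ zero-at)           ≡⟨ cong (jointNonzero b b +_) (∑-distrib-+ zero-at zero-at) ⟨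
    jointNonzero b b + ∑ (λ x → zero-at x + zero-at x)   ≡⟨ ∑-distrib-+ (λ x → 𝟙≢0 (x ⊗ b ⊕ λ′) * 𝟙≢0 (x ⊗ b ⊕ λ′)) (λ x → zero-at x + zero-at x) ⟨
    ∑ (λ x → 𝟙≢0 (x ⊗ b ⊕ λ′) * 𝟙≢0 (x ⊗ b ⊕ λ′) + (zero-at x + zero-at x)) ≡⟨ ∑-cong (λ x → pointwise (x ⊗ b ⊕ λ′)) ⟩
    ∑ (λ x → 1 + zero-at x)                               ≡⟨ ∑-distrib-+ (λ _ → 1) zero-at ⟩
    ∑ (λ _ → 1) + ∑ zero-at                               ≡⟨ cong₂ _+_ (trans (∑-const 1) (*-identityʳ q)) (∑-𝟙≡0-affineʳ λ′ b≢0) ⟩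
    q + 1                                                 ≡⟨ +-comm q 1 ⟩
    suc q                                                 ∎
    where
    open ≡-Reasoning
    zero-at : F → ℕ
    zero-at x = 𝟙≡0 (x ⊗ b ⊕ λ′)
    pointwise : ∀ u → 𝟙≢0 u * 𝟙≢0 u + (𝟙≡0 u + 𝟙≡0 u) ≡ 1 + 𝟙≡0 u
    pointwise u with u ≟ 0#
    ... | yes _ = refl
    ... | no _ = refl

  jointNonzero-off-diagonal : ∀ {b b′} → b ≢ 0# → b′ ≢ 0# → b ≢ b′ → jointNonzero b b′ + 2 ≡ q
  jointNonzero-off-diagonal {b} {b′} b≢0 b′≢0 b≢b′ = begin
    jointNonzero b b′ + 2                                       ≡⟨ cong₂ (λ k k′ → jointNonzero b b′ + (k + k′)) (∑-𝟙≡0-affineʳ λ′ b≢0) (∑-𝟙≡0-affineʳ λ′ b′≢0) ⟨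
    jointNonzero b b′ + (∑ (zero-at b) + ∑ (zero-at b′))        ≡⟨ cong (jointNonzero b b′ +_) (∑-distrib-+ (zero-at b) (zero-at b′)) ⟨
    jointNonzero b b′ + ∑ (λ x → zero-at b x + zero-at b′ x)    ≡⟨ ∑-distrib-+ (λ x → 𝟙≢0 (x ⊗ b ⊕ λ′) * 𝟙≢0 (x ⊗ b′ ⊕ λ′)) (λ x → zero-at b x + zero-at b′ x) ⟨
    ∑ (λ x → 𝟙≢0 (x ⊗ b ⊕ λ′) * 𝟙≢0 (x ⊗ b′ ⊕ λ′) + (zero-at b x + zero-at b′ x)) ≡⟨ ∑-cong (λ x → pointwise (not-both-zero x)) ⟩
    ∑ (λ _ → 1)                                                 ≡⟨ trans (∑-const 1) (*-identityʳ q) ⟩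
    q                                                           ∎
    where
    open ≡-Reasoning
    zero-at : F → F → ℕ
    zero-at c x = 𝟙≡0 (x ⊗ c ⊕ λ′)
    pointwise : ∀ {u v} → ¬ (u ≡ 0# × v ≡ 0#) → 𝟙≢0 u * 𝟙≢0 v + (𝟙≡0 u + 𝟙≡0 v) ≡ 1
    pointwise {u} {v} not-both with u ≟ 0# | v ≟ 0#
    ... | yes u≡0 | yes v≡0 = ⊥-elim (not-both (u≡0 , v≡0))
    ... | yes _ | no _ = refl
    ... | no _ | yes _ = refl
    ... | no _ | no _ = refl
    not-both-zero : ∀ x → ¬ (x ⊗ b ⊕ λ′ ≡ 0# × x ⊗ b′ ⊕ λ′ ≡ 0#)
    not-both-zero x (u≡0 , v≡0) = b≢b′ (*-cancelˡ x≢0 xb≡xb′)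
      where
      xb≡xb′ : x ⊗ b ≡ x ⊗ b′
      xb≡xb′ = trans (sym ([x⊕y]⊖y≡x (x ⊗ b) λ′)) (trans (cong (_⊕ ⊖ λ′) (trans u≡0 (sym v≡0))) ([x⊕y]⊖y≡x (x ⊗ b′) λ′))
      x≢0 : x ≢ 0#
      x≢0 refl = λ′≢0 (trans (sym (trans (cong (_⊕ λ′) (R.zeroˡ b)) (R.+-identityˡ λ′))) u≡0)

  ∑∑S²≡∑A²jointAffine : ∑ (λ x → ∑ (λ t → S x t * S x t)) ≡ ∑A² jointAffine
  ∑∑S²≡∑A²jointAffine = begin
    ∑ (λ x → ∑ (λ t → S x t * S x t))                 ≡⟨ ∑-comm (λ x t → S x t * S x t) ⟩
    ∑ (λ t → ∑ (λ x → S x t * S x t))                 ≡⟨ ∑-cong (λ t → ∑-∑-weighted-square α (λ x b → χ (t ⊗ (x ⊗ b ⊕ λ′)))) ⟩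
    ∑ (λ t → ∑A (λ b → ∑A (λ b′ → U t b b′)))        ≡⟨ ∑-weighted-comm α (λ t b → ∑A (λ b′ → U t b b′)) ⟩
    ∑A (λ b → ∑ (λ t → ∑A (λ b′ → U t b b′)))        ≡⟨ ∑-cong (λ b → cong (α b *_) (∑-weighted-comm α (λ t b′ → U t b b′))) ⟩
    ∑A² jointAffine                                   ∎
    where
    open ≡-Reasoning
    U : F → F → F → ℕ
    U t b b′ = ∑ (λ x → χ (t ⊗ (x ⊗ b ⊕ λ′)) * χ (t ⊗ (x ⊗ b′ ⊕ λ′)))

  ρ : F → ℕ
  ρ s = ∑A (λ b → χ (s ⊗ b))

  ∑ρ≡m*h : ∑ ρ ≡ m * h
  ∑ρ≡m*h = trans (∑-weighted-comm α (λ s b → χ (s ⊗ b)))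
                 (trans (∑A-cong (λ b∈as → ∑-scale χ (proj₂ distinct b∈as))) (∑A-const h))

  ρ-0 : ρ 0# ≡ 0
  ρ-0 = ∑-zero (λ b → trans (cong (λ z → α b * χ z) (R.zeroˡ b)) (trans (cong (α b *_) χ-0) (*-zeroʳ (α b))))

  moment-identity : ∑ (λ x → ∑ (λ t → S x t * S x t)) + ∑ (λ s → ρ s * ρ s) + m * (h * h) ≡
                    m * (q * h) + m * m * (h * h)
  moment-identity = begin
    ∑ (λ x → ∑ (λ t → S x t * S x t)) + ∑ (λ s → ρ s * ρ s) + m * (h * h)
      ≡⟨ cong₂ (λ X M → X + M + m * (h * h)) ∑∑S²≡∑A²jointAffine (∑-∑-weighted-square α (λ s b → χ (s ⊗ b))) ⟩
    ∑A² jointAffine + ∑A² jointLinear + m * (h * h)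
      ≡⟨ cong (_+ m * (h * h)) (∑A²-distrib-+ jointAffine jointLinear) ⟨
    ∑A² (λ b b′ → jointAffine b b′ + jointLinear b b′) + m * (h * h)
      ≡⟨ ∑A²-diagonal (λ b b′ → jointAffine b b′ + jointLinear b b′) diagonal off-diagonal ⟩
    m * (q * h) + m * m * (h * h) ∎
    where
    open ≡-Reasoning
    diagonal : ∀ {b} → b ∈ as → jointAffine b b + jointLinear b b ≡ q * h
    diagonal {b} b∈as = trans (jointAffine+jointLinear≡jointPlane b b) (jointPlane-diagonal (proj₂ distinct b∈as))
    off-diagonal : ∀ {b b′} → b ∈ as → b′ ∈ as → b ≢ b′ → jointAffine b b′ + jointLinear b b′ ≡ h * h
    off-diagonal {b} {b′} _ _ b≢b′ = trans (jointAffine+jointLinear≡jointPlane b b′) (jointPlane-off-diagonal b≢b′)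

  nonzeroCount-identity : ∑ (λ x → nonzeroCount x * nonzeroCount x) + m * (m * 2) + m * q ≡ m * suc q + m * m * q
  nonzeroCount-identity = begin
    ∑ (λ x → nonzeroCount x * nonzeroCount x) + m * (m * 2) + m * q
      ≡⟨ cong₂ (λ C T → C + T + m * q) (∑-∑-weighted-square α (λ x b → 𝟙≢0 (x ⊗ b ⊕ λ′))) (sym two-pairs) ⟩
    ∑A² jointNonzero + ∑A² (λ _ _ → 2) + m * q
      ≡⟨ cong (_+ m * q) (∑A²-distrib-+ jointNonzero (λ _ _ → 2)) ⟨
    ∑A² (λ b b′ → jointNonzero b b′ + 2) + m * q
      ≡⟨ ∑A²-diagonal (λ b b′ → jointNonzero b b′ + 2) (jointNonzero-diagonal ∘ proj₂ distinct)
           (λ b∈as b′∈as → jointNonzero-off-diagonal (proj₂ distinct b∈as) (proj₂ distinct b′∈as)) ⟩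
    m * suc q + m * m * q ∎
    where
    open ≡-Reasoning
    two-pairs : ∑A² (λ _ _ → 2) ≡ m * (m * 2)
    two-pairs = trans (∑A-cong (λ _ → ∑A-const 2)) (∑A-const (m * 2))

  second-moment-bound : ∀ (L : F → ℕ) → (∀ x → Deficit x (L x)) → ∑ L ≤ m * h * r * q
  second-moment-bound L deficit =
    second-moment-arithmetic {m = m} {h} {r} (sym suc-N≡q) N≡h+r P1 P2 moment-identity nonzeroCount-identity
    where
    P1 : h * h * ∑ (λ x → nonzeroCount x * nonzeroCount x) + ∑ L ≤ N * ∑ (λ x → ∑ (λ t → S x t * S x t))
    P1 = begin
      h * h * ∑ (λ x → nonzeroCount x * nonzeroCount x) + ∑ L
        ≡⟨ cong (_+ ∑ L) (∑-*ˡ (h * h) (λ x → nonzeroCount x * nonzeroCount x)) ⟨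
      ∑ (λ x → h * h * (nonzeroCount x * nonzeroCount x)) + ∑ L
        ≡⟨ ∑-distrib-+ (λ x → h * h * (nonzeroCount x * nonzeroCount x)) L ⟨
      ∑ (λ x → h * h * (nonzeroCount x * nonzeroCount x) + L x)
        ≡⟨ ∑-cong (λ x → cong (_+ L x) (trans (interchange h h _ _) (sym (cong₂ _*_ (∑S≡h*nonzeroCount x) (∑S≡h*nonzeroCount x))))) ⟩
      ∑ (λ x → ∑ (S x) * ∑ (S x) + L x)
        ≤⟨ ∑-mono-≤ deficit ⟩
      ∑ (λ x → N * ∑ (λ t → S x t * S x t))
        ≡⟨ ∑-*ˡ N (λ x → ∑ (λ t → S x t * S x t)) ⟩
      N * ∑ (λ x → ∑ (λ t → S x t * S x t)) ∎
      where open ≤-Reasoning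
    P2 : m * h * (m * h) ≤ N * ∑ (λ s → ρ s * ρ s)
    P2 = subst (λ σ → σ * σ ≤ N * ∑ (λ s → ρ s * ρ s)) ∑ρ≡m*h (∑-cauchy-schwarz-units ρ ρ-0)

  deficit-sum-bound : ∀ k → (∀ {x} → x ∈ as → Deficit x (k * k * (h * r))) → m * m + m * (k * k) ≤ m * q
  deficit-sum-bound k deficit-on-as = *-cancelʳ-≤ (m * m + m * (k * k)) (m * q) (h * r) (begin
    (m * m + m * (k * k)) * (h * r)                      ≡⟨ distribute m k (h * r) ⟩
    m * m * (h * r) + m * (k * k * (h * r))              ≡⟨ cong₂ _+_ (∑-δ 0# (λ _ → m * m * (h * r))) (∑A-const (k * k * (h * r))) ⟨
    ∑ (λ x → 𝟙≡0 x * (m * m * (h * r))) + ∑A (λ _ → k * k * (h * r)) ≡⟨ ∑-distrib-+ (λ x → 𝟙≡0 x * (m * m * (h * r))) (λ x → α x * (k * k * (h * r))) ⟨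
    ∑ L                                                  ≤⟨ second-moment-bound L deficit ⟩
    m * h * r * q                                        ≡⟨ rearrange m h r q ⟩
    m * q * (h * r)                                      ∎)
    where
    open ≤-Reasoning
    instance
      hr≢0 : NonZero (h * r)
      hr≢0 = >-nonZero (*-mono-≤ 1≤h (≤-trans 1≤h h≤r))
    distribute : ∀ m k c → (m * m + m * (k * k)) * c ≡ m * m * c + m * (k * k * c)
    distribute m k c = solve (m ∷ k ∷ c ∷ [])
    rearrange : ∀ m h r q → m * h * r * q ≡ m * q * (h * r)
    rearrange m h r q = solve (m ∷ h ∷ r ∷ q ∷ [])
    L : F → ℕ
    L x = 𝟙≡0 x * (m * m * (h * r)) + α x * (k * k * (h * r))
    deficit : ∀ x → Deficit x (𝟙 (x ≟ 0#) * (m * m * (h * r)) + 𝟙 (x ∈? as) * (k * k * (h * r)))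
    deficit x with x ≟ 0#
    ... | yes refl with 0# ∈? as
    ...   | yes 0∈as = ⊥-elim (0∉as 0∈as)
    ...   | no _ = subst (Deficit 0#) (sym (trans (+-identityʳ _) (+-identityʳ _))) deficit-at-0
    deficit x | no _ with x ∈? as
    ...   | yes x∈as = subst (Deficit x) (sym (+-identityʳ _)) (deficit-on-as x∈as)
    ...   | no _ = deficit-0 x

  1+nonzeroCount≥m : ∀ {x} → x ≢ 0# → m ≤ 1 + nonzeroCount x
  1+nonzeroCount≥m {x} x≢0 = begin
    m                                                     ≡⟨ trans (∑A-const 1) (*-identityʳ m) ⟨
    ∑A (λ _ → 1)                                          ≡⟨ ∑A-cong (λ {b} _ → 𝟙-+-𝟙¬ ((x ⊗ b ⊕ λ′) ≟ 0#)) ⟨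
    ∑A (λ b → 𝟙≡0 (x ⊗ b ⊕ λ′) + 𝟙≢0 (x ⊗ b ⊕ λ′))         ≡⟨ ∑A-distrib-+ (λ b → 𝟙≡0 (x ⊗ b ⊕ λ′)) (λ b → 𝟙≢0 (x ⊗ b ⊕ λ′)) ⟩
    ∑A (λ b → 𝟙≡0 (x ⊗ b ⊕ λ′)) + nonzeroCount x          ≤⟨ +-monoˡ-≤ (nonzeroCount x) (∑A≤∑ (λ b → 𝟙≡0 (x ⊗ b ⊕ λ′))) ⟩
    ∑ (λ b → 𝟙≡0 (x ⊗ b ⊕ λ′)) + nonzeroCount x           ≡⟨ cong (_+ nonzeroCount x) (∑-𝟙≡0-affineˡ λ′ x≢0) ⟩
    1 + nonzeroCount x                                    ∎
    where open ≤-Reasoning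

  SD-bound : (∀ {a b} → a ∈ as → b ∈ as → ResidueOrZero (a ⊗ b ⊕ λ′)) → m * m + m * ((m ∸ 1) * (m ∸ 1)) ≤ m * q
  SD-bound residue-or-zero = deficit-sum-bound (m ∸ 1) λ {x} x∈as →
    deficit-mono (*-monoˡ-≤ (h * r) (*-mono-≤ (lower-bound x∈as) (lower-bound x∈as)))
      (deficit-scaled-indicator (nonzeroCount x) χ χ-idem refl (S≡ x∈as))
    where
    lower-bound : ∀ {x} → x ∈ as → m ∸ 1 ≤ nonzeroCount x
    lower-bound x∈as = m≤n+o⇒m∸n≤o m 1 (1+nonzeroCount≥m (proj₂ distinct x∈as))
    S≡ : ∀ {x} → x ∈ as → ∀ t → S x t ≡ nonzeroCount x * χ t
    S≡ {x} x∈as t = trans (∑A-cong (λ b∈as → χ-*-residue-or-zero (residue-or-zero x∈as b∈as) t))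
                          (∑A-*ʳ (χ t) (λ b → 𝟙≢0 (x ⊗ b ⊕ λ′)))

  nonzeroCountExcept : F → ℕ
  nonzeroCountExcept x = ∑A (λ b → 𝟙 (¬? (b ≟ x)) * 𝟙≢0 (x ⊗ b ⊕ λ′))

  2+nonzeroCountExcept≥m : ∀ {x} → x ≢ 0# → m ≤ 2 + nonzeroCountExcept x
  2+nonzeroCountExcept≥m {x} x≢0 = begin
    m                                                           ≡⟨ trans (∑A-const 1) (*-identityʳ m) ⟨
    ∑A (λ _ → 1)                                                ≤⟨ ∑A-mono-≤ (λ {b} _ → cover b) ⟩
    ∑A (λ b → (𝟙 (b ≟ x) + 𝟙≡0 (x ⊗ b ⊕ λ′)) + except b)       ≡⟨ ∑A-distrib-+ (λ b → 𝟙 (b ≟ x) + 𝟙≡0 (x ⊗ b ⊕ λ′)) except ⟩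
    ∑A (λ b → 𝟙 (b ≟ x) + 𝟙≡0 (x ⊗ b ⊕ λ′)) + nonzeroCountExcept x
      ≤⟨ +-monoˡ-≤ _ (∑A≤∑ (λ b → 𝟙 (b ≟ x) + 𝟙≡0 (x ⊗ b ⊕ λ′))) ⟩
    ∑ (λ b → 𝟙 (b ≟ x) + 𝟙≡0 (x ⊗ b ⊕ λ′)) + nonzeroCountExcept x
      ≡⟨ cong (_+ nonzeroCountExcept x) (trans (∑-distrib-+ (λ b → 𝟙 (b ≟ x)) (λ b → 𝟙≡0 (x ⊗ b ⊕ λ′)))
                                                (cong₂ _+_ (∑-𝟙≡ x) (∑-𝟙≡0-affineˡ λ′ x≢0))) ⟩
    2 + nonzeroCountExcept x                                    ∎
    where
    open ≤-Reasoning
    except : F → ℕ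
    except b = 𝟙 (¬? (b ≟ x)) * 𝟙≢0 (x ⊗ b ⊕ λ′)
    cover : ∀ b → 1 ≤ (𝟙 (b ≟ x) + 𝟙≡0 (x ⊗ b ⊕ λ′)) + except b
    cover b with b ≟ x | (x ⊗ b ⊕ λ′) ≟ 0#
    ... | yes _ | _ = s≤s z≤n
    ... | no _ | yes _ = s≤s z≤n
    ... | no _ | no _ = s≤s z≤n

  D-bound : (∀ {a b} → a ∈ as → b ∈ as → a ≢ b → ResidueOrZero (a ⊗ b ⊕ λ′)) → m * m + m * ((m ∸ 3) * (m ∸ 3)) ≤ m * q
  D-bound residue-or-zero = deficit-sum-bound (m ∸ 3) λ {x} x∈as →
    deficit-mono (*-monoˡ-≤ (h * r) (*-mono-≤ (lower-bound x∈as) (lower-bound x∈as)))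
      (deficit-two-cosets (nonzeroCountExcept x) (x ⊗ x ⊕ λ′) (S≡ x∈as))
    where
    lower-bound : ∀ {x} → x ∈ as → m ∸ 3 ≤ nonzeroCountExcept x ∸ 1
    lower-bound {x} x∈as = subst (_≤ nonzeroCountExcept x ∸ 1) (∸-+-assoc m 2 1)
      (∸-monoˡ-≤ 1 (m≤n+o⇒m∸n≤o m 2 (2+nonzeroCountExcept≥m (proj₂ distinct x∈as))))
    S≡ : ∀ {x} → x ∈ as → ∀ t → S x t ≡ nonzeroCountExcept x * χ t + χ (t ⊗ (x ⊗ x ⊕ λ′))
    S≡ {x} x∈as t = begin
      S x t                                                                    ≡⟨ ∑A-split x∈as (λ b → χ (t ⊗ (x ⊗ b ⊕ λ′))) ⟩
      χ (t ⊗ (x ⊗ x ⊕ λ′)) + ∑A (λ b → 𝟙 (¬? (b ≟ x)) * χ (t ⊗ (x ⊗ b ⊕ λ′)))  ≡⟨ cong (χ (t ⊗ (x ⊗ x ⊕ λ′)) +_) (∑A-cong off-x) ⟩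
      χ (t ⊗ (x ⊗ x ⊕ λ′)) + ∑A (λ b → 𝟙 (¬? (b ≟ x)) * 𝟙≢0 (x ⊗ b ⊕ λ′) * χ t) ≡⟨ cong (χ (t ⊗ (x ⊗ x ⊕ λ′)) +_) (∑A-*ʳ (χ t) (λ b → 𝟙 (¬? (b ≟ x)) * 𝟙≢0 (x ⊗ b ⊕ λ′))) ⟩
      χ (t ⊗ (x ⊗ x ⊕ λ′)) + nonzeroCountExcept x * χ t                       ≡⟨ +-comm (χ (t ⊗ (x ⊗ x ⊕ λ′))) (nonzeroCountExcept x * χ t) ⟩
      nonzeroCountExcept x * χ t + χ (t ⊗ (x ⊗ x ⊕ λ′))                       ∎
      where
      open ≡-Reasoning
      off-x : ∀ {b} → b ∈ as → 𝟙 (¬? (b ≟ x)) * χ (t ⊗ (x ⊗ b ⊕ λ′)) ≡ 𝟙 (¬? (b ≟ x)) * 𝟙≢0 (x ⊗ b ⊕ λ′) * χ t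
      off-x {b} b∈as with b ≟ x
      ... | yes _ = refl
      ... | no b≢x = trans (+-identityʳ _) (trans (χ-*-residue-or-zero (residue-or-zero x∈as b∈as (b≢x ∘ sym)) t)
                                                 (cong (_* χ t) (sym (*-identityˡ (𝟙≢0 (x ⊗ b ⊕ λ′))))))

open FiniteField using (F; 0#; HasD; HasSD; size)

proposition1p3 : (K : FiniteField) (d : ℕ) →
    2 ≤ d →
    Σ ℕ (λ p → Σ ℕ (λ k → Prime p × 1 ≤ k × size K ≡ p ^ k)) →
    d ∣ (size K ∸ 1) →
    (λ′ : F K) → ¬ (λ′ ≡ 0# K) →
    ((as : List (F K)) → HasSD K d λ′ as →
      (2 * length as ∸ 1) ^ 2 + 3 ≤ 4 * size K)
    ×
    ((as : List (F K)) → HasD K d λ′ as →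
      (length as ≤ 2 ⊎ (2 * length as ∸ 5) ^ 2 + 11 ≤ 4 * size K))
proposition1p3 K d 2≤d _ d∣q-1 λ′ λ′≢0 =
  (λ as (distinct , residue-or-zero) →
    sd-arithmetic (length as) q 1≤q (Counting.SD-bound K d h+h≤N λ′ λ′≢0 as distinct residue-or-zero)) ,
  (λ as (distinct , residue-or-zero) →
    d-arithmetic (length as) q (Counting.D-bound K d h+h≤N λ′ λ′≢0 as distinct residue-or-zero))
  where
  open FieldProperties K using (q; N; suc-N≡q)
  1≤q : 1 ≤ q
  1≤q = subst (1 ≤_) suc-N≡q (s≤s z≤n)
  h+h≤N = PowerResidues.h+h≤N K d 2≤d (subst (d ∣_) (cong (_∸ 1) (sym suc-N≡q)) d∣q-1)
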